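{- Let $s\ge1$ and $r,k\ge0$ be integers. As formal power series in $x$, \[ \sum_{n\ge sk+(s-1)r}S^{(s)}_r(n+r,k+r)\frac{x^n}{n!}=\frac{1}{k!}\left(e^{x}-\sum_{i=0}^{s-1}\frac{x^i}{i!}\right)^{k}\left(e^{x}-\sum_{i=0}^{s-2}\frac{x^i}{i!}\right)^{r}. \]
   Context: Fix an integer $s\ge1$. For integers $n,k,r\ge0$, $S^{(s)}_r(n,k)$ is the number of partitions of $\{1,\dots,n\}$ into exactly $k$ nonempty blocks such that $1,\dots,r$ lie in pairwise distinct blocks and every block has at least $s$ elements. An empty sum (e.g. $\sum_{i=0}^{ -1}$ when $s=1$) is $0$. -}

module Defs where

open import Data.Bool using (Bool; true; false; _∧_; _∨_; not; if_then_else_)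
open import Data.Nat using (ℕ; zero; suc; _+_; _*_; _∸_; _!; _<ᵇ_; _≤ᵇ_)
open import Data.Nat.Properties using (_!≢0)
open import Data.Fin using (Fin; toℕ; _≟_)
import Data.Fin as Fin
open import Data.List using (List; []; _∷_; map; concatMap; length; filterᵇ; allFin; foldr)
open import Data.Integer using (+_)
open import Data.Rational using (ℚ; _/_; 0ℚ; 1ℚ) renaming (_+_ to _+ℚ_; _*_ to _*ℚ_; _-_ to _-ℚ_)
open import Relation.Nullary.Decidable using (⌊_⌋)

-- Set partitions of {1,…,n} (encoded as Fin n, element i+1 ↔ index i),
-- represented as equivalence relations on Fin n (Bool-valued).

allFuns : {A : Set} → List A → (n : ℕ) → List (Fin n → A)
allFuns xs zero    = (λ ()) ∷ []
allFuns xs (suc n) =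
  concatMap (λ a → map (λ f → λ { Fin.zero → a ; (Fin.suc i) → f i }) (allFuns xs n)) xs

allRels : (n : ℕ) → List (Fin n → Fin n → Bool)
allRels n = allFuns (allFuns (true ∷ false ∷ []) n) n

all : {A : Set} → (A → Bool) → List A → Bool
all p = foldr (λ a b → p a ∧ b) true

_⇒ᵇ_ : Bool → Bool → Bool
a ⇒ᵇ b = not a ∨ b

module _ {n : ℕ} (R : Fin n → Fin n → Bool) where
  isEquivᵇ : Bool
  isEquivᵇ =
    all (λ i → R i i) (allFin n) ∧
    all (λ i → all (λ j → R i j ⇒ᵇ R j i) (allFin n)) (allFin n) ∧
    all (λ i → all (λ j → all (λ l → (R i j ∧ R j l) ⇒ᵇ R i l) (allFin n)) (allFin n)) (allFin n)

  block : Fin n → List (Fin n)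
  block i = filterᵇ (R i) (allFin n)

  -- number of blocks = number of elements that are the least element of their block
  numBlocks : ℕ
  numBlocks = length (filterᵇ (λ i → all (λ j → (toℕ j <ᵇ toℕ i) ⇒ᵇ not (R j i)) (allFin n)) (allFin n))

  blocksAtLeast : ℕ → Bool
  blocksAtLeast s = all (λ i → s ≤ᵇ length (block i)) (allFin n)

  -- the elements 1,…,r (indices 0,…,r-1) lie in pairwise distinct blocks
  firstDistinct : ℕ → Bool
  firstDistinct r =
    all (λ i → all (λ j → ((toℕ i <ᵇ r) ∧ (toℕ j <ᵇ r) ∧ not ⌊ i ≟ j ⌋) ⇒ᵇ not (R i j)) (allFin n)) (allFin n)

Sr : (s r n k : ℕ) → ℕ
Sr s r n k = length (filterᵇ ok (allRels n))
  where
  ok : (Fin n → Fin n → Bool) → Bool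
  ok R = isEquivᵇ R ∧ (numBlocks R ≤ᵇ k) ∧ (k ≤ᵇ numBlocks R) ∧ blocksAtLeast R s ∧ firstDistinct R r

FPS : Set
FPS = ℕ → ℚ

sumℚ : ℕ → (ℕ → ℚ) → ℚ
sumℚ zero    f = 0ℚ
sumℚ (suc m) f = sumℚ m f +ℚ f m

_⊕_ : FPS → FPS → FPS
(f ⊕ g) n = f n +ℚ g n

_⊖_ : FPS → FPS → FPS
(f ⊖ g) n = f n -ℚ g n

_⊛_ : FPS → FPS → FPS
(f ⊛ g) n = sumℚ (suc n) (λ i → f i *ℚ g (n ∸ i))

oneS : FPS
oneS zero    = 1ℚ
oneS (suc n) = 0ℚ

zeroS : FPS
zeroS n = 0ℚ

_^S_ : FPS → ℕ → FPS
f ^S zero  = oneS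
f ^S suc k = f ⊛ (f ^S k)

scale : ℚ → FPS → FPS
scale c f n = c *ℚ f n

invFact : ℕ → ℚ
invFact n = ((+ 1) / (n !)) {{n !≢0}}

monomial : ℚ → ℕ → FPS
monomial c i n = if (i Data.Nat.≡ᵇ n) then c else 0ℚ

expS : FPS
expS n = invFact n

sumS : ℕ → (ℕ → FPS) → FPS
sumS zero    F = zeroS
sumS (suc m) F = sumS m F ⊕ F m

expTrunc : ℕ → FPS
expTrunc m = sumS m (λ i → monomial (invFact i) i)

lhsS : (s r k : ℕ) → FPS
lhsS s r k n =
  if (s * k + (s ∸ 1) * r) ≤ᵇ n
  then ((+ Sr s r (n + r) (k + r)) / (n !)) {{n !≢0}}
  else 0ℚ

rhsS : (s r k : ℕ) → FPS
rhsS s r k = scale (invFact k) (((expS ⊖ expTrunc s) ^S k) ⊛ ((expS ⊖ expTrunc (s ∸ 1)) ^S r))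

module Submission where

-- Let A_u = eˣ − Σ_{i<u} xⁱ/i!, whose n-th coefficient is [u ≤ n]/n!, and for thresholds
-- t : Fin M → ℕ let P M t n = n! [xⁿ] Π_b A_{t b}.  As A_u' = A_{u-1}, the product rule gives
-- P t (n+1) = Σ_a P (t lowered at a) n, and with P t 0 = [t = 0] this recursion determines P
-- (threshold families).  By uniqueness, P is symmetric in t and splits along a decomposition
-- of the factors into two groups.
--
-- Combinatorially, a partition counted by S^{(s)}_r(r + n, k + r) amounts to a labelled
-- partition of Fin n: each element carries one of r labels (the class of a distinguished
-- element, of size ≥ s − 1 without it) or lies in one of k blocks of size ≥ s.  For arbitrary
-- label thresholds τ, removing the first element gives a recursion for the number U of labelled
-- partitions -- the element carries a label, or it opens a block which becomes a new label --
-- showing k! U = P (s, …, s, τ).  Both identifications count through bijections, using a general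
-- double-counting lemma for enumerated decidable setoids.

open import Defs
open import Level using (0ℓ)
open import Data.Bool using (Bool; true; false; _∧_; _∨_; not; if_then_else_)
import Data.Bool.Properties as Bool
open import Data.Empty using (⊥; ⊥-elim)
open import Data.Nat using (ℕ; zero; suc; _+_; _*_; _∸_; _≤_; _<_; s≤s; s≤s⁻¹; _<ᵇ_; _≤ᵇ_; _<?_; _≤?_; _!; NonZero)
import Data.Nat as ℕ
open import Data.Nat.Properties hiding (_≟_)
open import Data.Nat.Combinatorics using (_C_; nCk+nC[k+1]≡[n+1]C[k+1]; k>n⇒nCk≡0; nCk≡n!/k![n-k]!; k![n∸k]!∣n!)
open import Data.Nat.DivMod using (m/n*n≡m)
open import Data.Nat.Solver using (module +-*-Solver)
open +-*-Solver using (solve; _:+_; _:*_; _:=_)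
open import Data.Fin using (Fin; toℕ; fromℕ; inject₁; cast; splitAt; _↑ˡ_; _↑ʳ_; _≟_)
import Data.Fin as Fin
open import Data.Fin.Properties
  using (toℕ-inject₁; toℕ-fromℕ; toℕ<n; toℕ-↑ˡ; toℕ-↑ʳ; splitAt-↑ˡ; splitAt-↑ʳ; all?; ¬∀⟶∃¬; ↑ˡ-injective; ↑ʳ-injective; cast-is-id)
  renaming (≡-decSetoid to Fin-decSetoid; suc-injective to fs-injective)
open import Data.Fin.Permutation using (Permutation; _⟨$⟩ʳ_; _⟨$⟩ˡ_; inverseˡ; inverseʳ)
import Data.Fin.Permutation as Perm
open import Data.Fin.Permutation.Components using (transpose; transpose-inverse)
import Data.Vec.Functional.Relation.Binary.Pointwise.Properties as Pointwise
open import Data.List using (List; []; _∷_; map; concatMap; length; filterᵇ; allFin; _++_; tabulate)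
open import Data.Product using (Σ; _×_; _,_; proj₁; proj₂)
open import Data.Product.Relation.Binary.Pointwise.NonDependent using (×-decSetoid)
open import Data.Sum using ([_,_]′; inj₁; inj₂)
import Data.Integer as ℤ
import Data.Integer.Properties as ℤ
open import Data.Rational using (ℚ; _/_; 0ℚ; toℚᵘ) renaming (_+_ to _+ℚ_; _*_ to _*ℚ_; _-_ to _-ℚ_)
import Data.Rational.Properties as ℚ
open import Data.Rational.Unnormalised using (mkℚᵘ; *≡*) renaming (_≃_ to _≃ᵘ_)
import Data.Rational.Unnormalised.Properties as ℚᵘ
open import Algebra.Properties.Semiring.Sum +-*-semiring
  using (sum; sum-syntax; sum-cong-≗; ∑-distrib-+; ∑-comm; sum-permute; sum-init-last; *-distribˡ-sum; *-distribʳ-sum)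
open import Relation.Binary using (DecSetoid)
open import Relation.Binary.PropositionalEquality
open import Relation.Nullary using (Dec; ¬_; does; yes; no; contradiction; _×-dec_; _→-dec_)
open import Relation.Nullary.Decidable using (map′; does-≡; dec-true; dec-false; isYes≗does; ⌊_⌋; toSum)
open import Function using (_∘_; id)

pattern fz   = Fin.zero
pattern fs i = Fin.suc i

ind : Bool → ℕ
ind true  = 1
ind false = 0

ind-∧ : ∀ a b → ind (a ∧ b) ≡ ind a * ind b
ind-∧ true  b = sym (+-identityʳ (ind b))
ind-∧ false b = refl

bool-ext : {a b : Bool} → (a ≡ true → b ≡ true) → (b ≡ true → a ≡ true) → a ≡ b
bool-ext {true}  {true}  _ _ = refl
bool-ext {true}  {false} f _ = sym (f refl)
bool-ext {false} {true}  _ g = g refl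
bool-ext {false} {false} _ _ = refl

∧-intro : {a b : Bool} → a ≡ true → b ≡ true → (a ∧ b) ≡ true
∧-intro refl refl = refl

∧-elimˡ : {a b : Bool} → (a ∧ b) ≡ true → a ≡ true
∧-elimˡ {true} _ = refl

∧-elimʳ : {a b : Bool} → (a ∧ b) ≡ true → b ≡ true
∧-elimʳ {true} b≡t = b≡t

∨-elim : {a b : Bool} {C : Set} → (a ∨ b) ≡ true → (a ≡ true → C) → (b ≡ true → C) → C
∨-elim {true}  _ f g = f refl
∨-elim {false} h f g = g h

∨-introˡ : {a : Bool} (b : Bool) → a ≡ true → (a ∨ b) ≡ true
∨-introˡ b refl = refl

∨-introʳ : (a : Bool) {b : Bool} → b ≡ true → (a ∨ b) ≡ true
∨-introʳ true  _ = refl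
∨-introʳ false h = h

⇒-intro : {a b : Bool} → (a ≡ true → b ≡ true) → (a ⇒ᵇ b) ≡ true
⇒-intro {true}  f = f refl
⇒-intro {false} f = refl

⇒-elim : {a b : Bool} → (a ⇒ᵇ b) ≡ true → a ≡ true → b ≡ true
⇒-elim {true} h refl = h

not-true : {b : Bool} → not b ≡ true → b ≡ false
not-true {false} _ = refl

witness : {A : Set} (d : Dec A) → does d ≡ true → A
witness (yes a) _ = a

does-⇔ : {A B : Set} → (A → B) → (B → A) → (a? : Dec A) (b? : Dec B) → does a? ≡ does b?
does-⇔ f g a? b? = does-≡ a? (map′ g f b?)

≟-sym : {m : ℕ} (x y : Fin m) → does (x ≟ y) ≡ does (y ≟ x)
≟-sym x y = does-⇔ sym sym (x ≟ y) (y ≟ x)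

_◂_ : {A : Set} {n : ℕ} → A → (Fin n → A) → Fin (suc n) → A
(a ◂ f) fz     = a
(a ◂ f) (fs i) = f i

sum-↑ : (k r : ℕ) (f : Fin (k + r) → ℕ) → sum f ≡ sum (f ∘ (_↑ˡ r)) + sum (f ∘ (k ↑ʳ_))
sum-↑ zero    r f = refl
sum-↑ (suc k) r f = trans (cong (f fz +_) (sum-↑ k r (f ∘ fs))) (sym (+-assoc (f fz) _ _))

sum-const : (m c : ℕ) → ∑[ i < m ] c ≡ m * c
sum-const zero    c = refl
sum-const (suc m) c = cong (c +_) (sum-const m c)

sum-zero : {m : ℕ} (f : Fin m → ℕ) → (∀ i → f i ≡ 0) → sum f ≡ 0
sum-zero {m} f f≡0 = trans (sum-cong-≗ f≡0) (trans (sum-const m 0) (*-zeroʳ m))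

-- conv X Y n = Σ_{i ≤ n} (n choose i) X i Y (n - i):  the n-th coefficient, times n!,
-- of the product of the exponential generating functions of X and Y.
conv : (ℕ → ℕ) → (ℕ → ℕ) → ℕ → ℕ
conv X Y n = ∑[ i < suc n ] ((n C toℕ i) * X (toℕ i) * Y (n ∸ toℕ i))

conv-cong : {X X' Y Y' : ℕ → ℕ} → (∀ i → X i ≡ X' i) → (∀ i → Y i ≡ Y' i) → ∀ n → conv X Y n ≡ conv X' Y' n
conv-cong eX eY n = sum-cong-≗ {suc n} (λ i → cong₂ _*_ (cong ((n C toℕ i) *_) (eX (toℕ i))) (eY (n ∸ toℕ i)))

conv-zero : (X Y : ℕ → ℕ) → conv X Y 0 ≡ X 0 * Y 0
conv-zero X Y = trans (+-identityʳ _) (cong (_* Y 0) (+-identityʳ (X 0)))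

-- Leibniz rule: the derivative of a product, via Pascal's rule.
leibniz : (X Y : ℕ → ℕ) (n : ℕ) → conv X Y (suc n) ≡ conv (X ∘ suc) Y n + conv X (Y ∘ suc) n
leibniz X Y n = begin
    conv X Y (suc n)
  ≡⟨ cong (head +_) (trans (sum-cong-≗ pascal) (∑-distrib-+ lower upper)) ⟩
    head + (conv (X ∘ suc) Y n + sum upper)
  ≡⟨ x+[y+z]≡y+[x+z] head (conv (X ∘ suc) Y n) (sum upper) ⟩
    conv (X ∘ suc) Y n + (head + sum upper)
  ≡⟨ cong (λ z → conv (X ∘ suc) Y n + (head + z)) upper-sum ⟩
    conv (X ∘ suc) Y n + conv X (Y ∘ suc) n ∎
  where
  open ≡-Reasoning
  x+[y+z]≡y+[x+z] : ∀ x y z → x + (y + z) ≡ y + (x + z)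
  x+[y+z]≡y+[x+z] x y z = trans (sym (+-assoc x y z)) (trans (cong (_+ z) (+-comm x y)) (+-assoc y x z))
  head = 1 * X 0 * Y (suc n)
  lower upper : Fin (suc n) → ℕ
  lower i = (n C toℕ i) * X (suc (toℕ i)) * Y (n ∸ toℕ i)
  upper i = (n C suc (toℕ i)) * X (suc (toℕ i)) * Y (n ∸ toℕ i)
  pascal : ∀ i → (suc n C suc (toℕ i)) * X (suc (toℕ i)) * Y (n ∸ toℕ i) ≡ lower i + upper i
  pascal i = trans (cong (λ c → c * X (suc (toℕ i)) * Y (n ∸ toℕ i)) (sym (nCk+nC[k+1]≡[n+1]C[k+1] n (toℕ i))))
    (trans (cong (_* Y (n ∸ toℕ i)) (*-distribʳ-+ (X (suc (toℕ i))) (n C toℕ i) (n C suc (toℕ i))))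
           (*-distribʳ-+ (Y (n ∸ toℕ i)) ((n C toℕ i) * X (suc (toℕ i))) ((n C suc (toℕ i)) * X (suc (toℕ i)))))
  -- the last upper term contains n C (n+1) = 0; the others are the tail of conv X (Y ∘ suc) n
  last-vanishes : upper (fromℕ n) ≡ 0
  last-vanishes rewrite toℕ-fromℕ n | k>n⇒nCk≡0 {n} {suc n} (n<1+n n) = refl
  shift : ∀ (i : Fin n) → upper (inject₁ i) ≡ (n C toℕ (fs i)) * X (toℕ (fs i)) * Y (suc (n ∸ toℕ (fs i)))
  shift i rewrite toℕ-inject₁ i = cong (λ m → (n C suc (toℕ i)) * X (suc (toℕ i)) * Y m) (+-∸-assoc 1 (toℕ<n i))
  upper-sum : sum upper ≡ ∑[ i < n ] ((n C toℕ (fs i)) * X (toℕ (fs i)) * Y (suc (n ∸ toℕ (fs i))))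
  upper-sum = trans (sum-init-last upper) (trans (cong (sum (upper ∘ inject₁) +_) last-vanishes)
                    (trans (+-identityʳ _) (sum-cong-≗ shift)))

conv-sumʳ : {M : ℕ} (X : ℕ → ℕ) (G : Fin M → ℕ → ℕ) (n : ℕ) →
  conv X (λ m → ∑[ a < M ] G a m) n ≡ ∑[ a < M ] conv X (G a) n
conv-sumʳ {M} X G n = trans (sum-cong-≗ {suc n} (λ i → *-distribˡ-sum {M} ((n C toℕ i) * X (toℕ i)) (λ a → G a (n ∸ toℕ i))))
                            (∑-comm {suc n} {M} (λ i a → (n C toℕ i) * X (toℕ i) * G a (n ∸ toℕ i)))

conv-sumˡ : {M : ℕ} (G : Fin M → ℕ → ℕ) (Y : ℕ → ℕ) (n : ℕ) →
  conv (λ m → ∑[ a < M ] G a m) Y n ≡ ∑[ a < M ] conv (G a) Y n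
conv-sumˡ {M} G Y n = trans (sum-cong-≗ {suc n} distrib) (∑-comm {suc n} {M} (λ i a → (n C toℕ i) * G a (toℕ i) * Y (n ∸ toℕ i)))
  where
  distrib : ∀ i → (n C toℕ i) * (∑[ a < M ] G a (toℕ i)) * Y (n ∸ toℕ i)
                ≡ ∑[ a < M ] ((n C toℕ i) * G a (toℕ i) * Y (n ∸ toℕ i))
  distrib i = begin
      (n C toℕ i) * (∑[ a < M ] G a (toℕ i)) * Y (n ∸ toℕ i)
    ≡⟨ cong (_* Y (n ∸ toℕ i)) (*-distribˡ-sum (n C toℕ i) (λ a → G a (toℕ i))) ⟩
      (∑[ a < M ] ((n C toℕ i) * G a (toℕ i))) * Y (n ∸ toℕ i)
    ≡⟨ *-distribʳ-sum (Y (n ∸ toℕ i)) (λ a → (n C toℕ i) * G a (toℕ i)) ⟩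
      ∑[ a < M ] ((n C toℕ i) * G a (toℕ i) * Y (n ∸ toℕ i)) ∎
    where open ≡-Reasoning

conv-vanish : (X Y : ℕ → ℕ) (a b n : ℕ) → (∀ i → i < a → X i ≡ 0) → (∀ j → j < b → Y j ≡ 0) →
  n < a + b → conv X Y n ≡ 0
conv-vanish X Y a b n X<a Y<b n<a+b = sum-zero _ term
  where
  term : ∀ (i : Fin (suc n)) → (n C toℕ i) * X (toℕ i) * Y (n ∸ toℕ i) ≡ 0
  term i with toℕ i <? a
  ... | yes i<a = trans (cong (λ x → (n C toℕ i) * x * Y (n ∸ toℕ i)) (X<a (toℕ i) i<a))
                        (cong (_* Y (n ∸ toℕ i)) (*-zeroʳ (n C toℕ i)))
  ... | no i≮a = trans (cong ((n C toℕ i) * X (toℕ i) *_) (Y<b (n ∸ toℕ i) n∸i<b)) (*-zeroʳ ((n C toℕ i) * X (toℕ i)))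
    where
    n∸i<b : n ∸ toℕ i < b
    n∸i<b = +-cancelˡ-< a (n ∸ toℕ i) b (≤-<-trans (+-monoˡ-≤ (n ∸ toℕ i) (≮⇒≥ i≮a))
              (≤-<-trans (≤-reflexive (m+[n∸m]≡n (s≤s⁻¹ (toℕ<n i)))) n<a+b))

Thresholds : ℕ → Set
Thresholds M = Fin M → ℕ

lowerAt : {M : ℕ} → Thresholds M → Fin M → Thresholds M
lowerAt t a b = if does (a ≟ b) then t b ∸ 1 else t b

-- The numbers
-- n! [xⁿ] Π_b (eˣ − Σ_{i < t b} xⁱ/i!) form such a family (see P below),
-- and this data determines the family completely.
record ThresholdFamily (M : ℕ) (F : Thresholds M → ℕ → ℕ) : Set where
  field
    base-zero : ∀ t → (∀ b → t b ≡ 0) → F t 0 ≡ 1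
    base-pos  : ∀ t b → t b ≢ 0 → F t 0 ≡ 0
    step      : ∀ t n → F t (suc n) ≡ ∑[ a < M ] F (lowerAt t a) n

families-agree : {M : ℕ} {F G : Thresholds M → ℕ → ℕ} →
  ThresholdFamily M F → ThresholdFamily M G → ∀ n t → F t n ≡ G t n
families-agree {M} FF GG zero t with all? (λ b → t b ℕ.≟ 0)
... | yes t≡0 = trans (base-zero FF t t≡0) (sym (base-zero GG t t≡0))
  where open ThresholdFamily
... | no t≢0 with (b , tb≢0) ← ¬∀⟶∃¬ M (λ b → t b ≡ 0) (λ b → t b ℕ.≟ 0) t≢0
    = trans (base-pos FF t b tb≢0) (sym (base-pos GG t b tb≢0))
  where open ThresholdFamily
families-agree {M} FF GG (suc n) t =
  trans (ThresholdFamily.step FF t n)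
        (trans (sum-cong-≗ (λ a → families-agree FF GG n (lowerAt t a))) (sym (ThresholdFamily.step GG t n)))

-- n! [xⁿ] (eˣ − Σ_{i < u} xⁱ/i!) = [u ≤ n]
atLeast : ℕ → ℕ → ℕ
atLeast u n = ind (u ≤ᵇ n)

-- differentiating eˣ − Σ_{i < u} xⁱ/i! lowers u by one
atLeast-suc : ∀ u n → atLeast u (suc n) ≡ atLeast (u ∸ 1) n
atLeast-suc zero          n = refl
atLeast-suc (suc zero)    n = refl
atLeast-suc (suc (suc u)) n = refl

-- P M t n = n! [xⁿ] Π_{b < M} (eˣ − Σ_{i < t b} xⁱ/i!)
P : (M : ℕ) → Thresholds M → ℕ → ℕ
P zero    t zero    = 1
P zero    t (suc n) = 0
P (suc M) t         = conv (atLeast (t fz)) (P M (t ∘ fs))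

P-cong : (M : ℕ) {t t' : Thresholds M} → (∀ b → t b ≡ t' b) → ∀ n → P M t n ≡ P M t' n
P-cong zero    e zero    = refl
P-cong zero    e (suc n) = refl
P-cong (suc M) e n = conv-cong (λ i → cong (λ u → atLeast u i) (e fz)) (P-cong M (e ∘ fs)) n

-- The product rule for derivatives makes P a threshold family.
P-family : (M : ℕ) → ThresholdFamily M (P M)
P-family M = record { base-zero = base-zero M ; base-pos = base-pos M ; step = step M }
  where
  base-zero : (M : ℕ) (t : Thresholds M) → (∀ b → t b ≡ 0) → P M t 0 ≡ 1
  base-zero zero    t t≡0 = refl
  base-zero (suc M) t t≡0 rewrite t≡0 fz = trans (conv-zero (atLeast 0) (P M (t ∘ fs)))
    (trans (+-identityʳ _) (base-zero M (t ∘ fs) (t≡0 ∘ fs)))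
  base-pos : (M : ℕ) (t : Thresholds M) (b : Fin M) → t b ≢ 0 → P M t 0 ≡ 0
  base-pos (suc M) t fz tb≢0 with t fz in e
  ... | zero  = contradiction refl tb≢0
  ... | suc u = refl
  base-pos (suc M) t (fs b) tb≢0 = trans (conv-zero (atLeast (t fz)) (P M (t ∘ fs)))
    (trans (cong (atLeast (t fz) 0 *_) (base-pos M (t ∘ fs) b tb≢0)) (*-zeroʳ (atLeast (t fz) 0)))
  step : (M : ℕ) (t : Thresholds M) (n : ℕ) → P M t (suc n) ≡ ∑[ a < M ] P M (lowerAt t a) n
  step zero    t n = refl
  step (suc M) t n = begin
      P (suc M) t (suc n)
    ≡⟨ leibniz (atLeast (t fz)) (P M (t ∘ fs)) n ⟩
      conv (atLeast (t fz) ∘ suc) (P M (t ∘ fs)) n + conv (atLeast (t fz)) (P M (t ∘ fs) ∘ suc) n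
    ≡⟨ cong₂ _+_ (conv-cong {Y = P M (t ∘ fs)} (atLeast-suc (t fz)) (λ _ → refl) n)
                 (trans (conv-cong {X = atLeast (t fz)} (λ _ → refl) (step M (t ∘ fs)) n)
                        (conv-sumʳ (atLeast (t fz)) (λ a → P M (lowerAt (t ∘ fs) a)) n)) ⟩
      P (suc M) (lowerAt t fz) n + ∑[ a < M ] P (suc M) (lowerAt t (fs a)) n ∎
    where open ≡-Reasoning

module _ {m M : ℕ} (f : Fin m → Fin M) where

  lowerAt-inj : (∀ {a c} → f a ≡ f c → a ≡ c) → (t : Thresholds M) (a : Fin m) →
    ∀ c → lowerAt t (f a) (f c) ≡ lowerAt (t ∘ f) a c
  lowerAt-inj f-inj t a c with a ≟ c
  ... | yes refl rewrite dec-true (f a ≟ f a) refl = refl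
  ... | no a≢c   rewrite dec-false (f a ≟ f c) (a≢c ∘ f-inj) = refl

  lowerAt-outside : (t : Thresholds M) (x : Fin M) → (∀ c → x ≢ f c) → ∀ c → lowerAt t x (f c) ≡ t (f c)
  lowerAt-outside t x x∉f c rewrite dec-false (x ≟ f c) (x∉f c) = refl

data Side (k r : ℕ) : Fin (k + r) → Set where
  left  : (a : Fin k) → Side k r (a ↑ˡ r)
  right : (b : Fin r) → Side k r (k ↑ʳ b)

side : (k r : ℕ) (x : Fin (k + r)) → Side k r x
side zero    r x = right x
side (suc k) r fz = left fz
side (suc k) r (fs x) with side k r x
... | left a  = left (fs a)
... | right b = right b

↑ˡ≢↑ʳ : {k r : ℕ} (a : Fin k) (b : Fin r) → a ↑ˡ r ≢ k ↑ʳ b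
↑ˡ≢↑ʳ fz    b ()
↑ˡ≢↑ʳ (fs a) b e = ↑ˡ≢↑ʳ a b (fs-injective e)

-- The product over k + r factors is the product of the products over the two groups:
-- the binomial convolution of the two P's is a threshold family on Fin (k + r).
module _ (k r : ℕ) where

  private
    module Pk = ThresholdFamily (P-family k)
    module Pr = ThresholdFamily (P-family r)

  Split : Thresholds (k + r) → ℕ → ℕ
  Split t = conv (P k (t ∘ (_↑ˡ r))) (P r (t ∘ (k ↑ʳ_)))

  Split-lowerˡ : (t : Thresholds (k + r)) (a : Fin k) →
    ∀ n → Split (lowerAt t (a ↑ˡ r)) n ≡ conv (P k (lowerAt (t ∘ (_↑ˡ r)) a)) (P r (t ∘ (k ↑ʳ_))) n
  Split-lowerˡ t a = conv-cong (P-cong k (lowerAt-inj (_↑ˡ r) (↑ˡ-injective r _ _) t a))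
                               (P-cong r (lowerAt-outside (k ↑ʳ_) t (a ↑ˡ r) (↑ˡ≢↑ʳ a)))

  Split-lowerʳ : (t : Thresholds (k + r)) (b : Fin r) →
    ∀ n → Split (lowerAt t (k ↑ʳ b)) n ≡ conv (P k (t ∘ (_↑ˡ r))) (P r (lowerAt (t ∘ (k ↑ʳ_)) b)) n
  Split-lowerʳ t b = conv-cong (P-cong k (lowerAt-outside (_↑ˡ r) t (k ↑ʳ b) (λ a e → ↑ˡ≢↑ʳ a b (sym e))))
                               (P-cong r (lowerAt-inj (k ↑ʳ_) (↑ʳ-injective k _ _) t b))

  Split-zero : ∀ t → Split t 0 ≡ P k (t ∘ (_↑ˡ r)) 0 * P r (t ∘ (k ↑ʳ_)) 0
  Split-zero t = conv-zero (P k (t ∘ (_↑ˡ r))) (P r (t ∘ (k ↑ʳ_)))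

  -- by the Leibniz rule, each group contributes the terms lowering one of its thresholds
  Split-step : ∀ t n → Split t (suc n) ≡ ∑[ x < k + r ] Split (lowerAt t x) n
  Split-step t n = begin
      Split t (suc n)
    ≡⟨ leibniz (P k (t ∘ (_↑ˡ r))) (P r (t ∘ (k ↑ʳ_))) n ⟩
      conv (P k (t ∘ (_↑ˡ r)) ∘ suc) (P r (t ∘ (k ↑ʳ_))) n + conv (P k (t ∘ (_↑ˡ r))) (P r (t ∘ (k ↑ʳ_)) ∘ suc) n
    ≡⟨ cong₂ _+_ (trans (conv-cong {Y = P r (t ∘ (k ↑ʳ_))} (Pk.step (t ∘ (_↑ˡ r))) (λ _ → refl) n)
                        (conv-sumˡ (λ a → P k (lowerAt (t ∘ (_↑ˡ r)) a)) (P r (t ∘ (k ↑ʳ_))) n))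
                 (trans (conv-cong {X = P k (t ∘ (_↑ˡ r))} (λ _ → refl) (Pr.step (t ∘ (k ↑ʳ_))) n)
                        (conv-sumʳ (P k (t ∘ (_↑ˡ r))) (λ b → P r (lowerAt (t ∘ (k ↑ʳ_)) b)) n)) ⟩
      ∑[ a < k ] conv (P k (lowerAt (t ∘ (_↑ˡ r)) a)) (P r (t ∘ (k ↑ʳ_))) n
        + ∑[ b < r ] conv (P k (t ∘ (_↑ˡ r))) (P r (lowerAt (t ∘ (k ↑ʳ_)) b)) n
    ≡⟨ sym (cong₂ _+_ (sum-cong-≗ (λ a → Split-lowerˡ t a n)) (sum-cong-≗ (λ b → Split-lowerʳ t b n))) ⟩
      ∑[ a < k ] Split (lowerAt t (a ↑ˡ r)) n + ∑[ b < r ] Split (lowerAt t (k ↑ʳ b)) n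
    ≡⟨ sym (sum-↑ k r (λ x → Split (lowerAt t x) n)) ⟩
      ∑[ x < k + r ] Split (lowerAt t x) n ∎
    where open ≡-Reasoning

  Split-family : ThresholdFamily (k + r) Split
  Split-family = record
    { base-zero = λ t t≡0 → trans (Split-zero t)
        (cong₂ _*_ (Pk.base-zero _ (t≡0 ∘ (_↑ˡ r))) (Pr.base-zero _ (t≡0 ∘ (k ↑ʳ_))))
    ; base-pos = base-pos
    ; step = Split-step
    }
    where
    base-pos : ∀ t x → t x ≢ 0 → Split t 0 ≡ 0
    base-pos t x tx≢0 with side k r x
    ... | left a  = trans (Split-zero t) (cong (_* P r (t ∘ (k ↑ʳ_)) 0) (Pk.base-pos _ a tx≢0))
    ... | right b = trans (Split-zero t) (trans (cong (P k (t ∘ (_↑ˡ r)) 0 *_) (Pr.base-pos _ b tx≢0))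
                                                (*-zeroʳ (P k (t ∘ (_↑ˡ r)) 0)))

  P-split : (t : Thresholds (k + r)) (n : ℕ) → P (k + r) t n ≡ Split t n
  P-split t n = families-agree (P-family (k + r)) Split-family n t

P-permute : {M M' : ℕ} (π : Permutation M M') (t : Thresholds M') (n : ℕ) →
  P M (t ∘ (π ⟨$⟩ʳ_)) n ≡ P M' t n
P-permute {M} {M'} π t n = families-agree permuted-family (P-family M') n t
  where
  σ : Fin M → Fin M'
  σ = π ⟨$⟩ʳ_
  σ-injective : ∀ {a c} → σ a ≡ σ c → a ≡ c
  σ-injective e = trans (sym (inverseˡ π)) (trans (cong (π ⟨$⟩ˡ_) e) (inverseˡ π))
  module PM = ThresholdFamily (P-family M)
  permuted-family : ThresholdFamily M' (λ t → P M (t ∘ σ))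
  permuted-family = record
    { base-zero = λ t t≡0 → PM.base-zero (t ∘ σ) (t≡0 ∘ σ)
    ; base-pos  = λ t b tb≢0 → PM.base-pos (t ∘ σ) (π ⟨$⟩ˡ b) (subst (λ x → t x ≢ 0) (sym (inverseʳ π)) tb≢0)
    ; step      = λ t n → begin
        P M (t ∘ σ) (suc n)
      ≡⟨ PM.step (t ∘ σ) n ⟩
        ∑[ a < M ] P M (lowerAt (t ∘ σ) a) n
      ≡⟨ sum-cong-≗ (λ a → sym (P-cong M (lowerAt-inj σ σ-injective t a) n)) ⟩
        ∑[ a < M ] P M (lowerAt t (σ a) ∘ σ) n
      ≡⟨ sym (sum-permute (λ b → P M (lowerAt t b ∘ σ) n) π) ⟩
        ∑[ b < M' ] P M (lowerAt t b ∘ σ) n ∎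
    }
    where open ≡-Reasoning

withBlocks : (s k : ℕ) {r : ℕ} → Thresholds r → Thresholds (k + r)
withBlocks s zero    τ = τ
withBlocks s (suc k) τ fz     = s
withBlocks s (suc k) τ (fs x) = withBlocks s k τ x

withBlocks-↑ˡ : (s k : ℕ) {r : ℕ} (τ : Thresholds r) (a : Fin k) → withBlocks s k τ (a ↑ˡ r) ≡ s
withBlocks-↑ˡ s (suc k) τ fz     = refl
withBlocks-↑ˡ s (suc k) τ (fs a) = withBlocks-↑ˡ s k τ a

withBlocks-↑ʳ : (s k : ℕ) {r : ℕ} (τ : Thresholds r) (b : Fin r) → withBlocks s k τ (k ↑ʳ b) ≡ τ b
withBlocks-↑ʳ s zero    τ b = refl
withBlocks-↑ʳ s (suc k) τ b = withBlocks-↑ʳ s k τ b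

withBlocks-lowerʳ : (s k : ℕ) {r : ℕ} (τ : Thresholds r) (l : Fin r) →
  ∀ x → lowerAt (withBlocks s k τ) (k ↑ʳ l) x ≡ withBlocks s k (lowerAt τ l) x
withBlocks-lowerʳ s zero    τ l x = refl
withBlocks-lowerʳ s (suc k) τ l fz     = refl
withBlocks-lowerʳ s (suc k) τ l (fs x) = withBlocks-lowerʳ s k τ l x

transpose-fixes : {M : ℕ} (t : Thresholds M) (i j : Fin M) → t i ≡ t j → ∀ x → t (transpose i j x) ≡ t x
transpose-fixes t i j ti≡tj x with x ≟ i
... | yes refl = sym ti≡tj
... | no _ with x ≟ j
...   | yes refl = ti≡tj
...   | no _     = refl

transpose-hits : {M : ℕ} (i j : Fin M) → transpose i j j ≡ i
transpose-hits i j with j ≟ i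
... | yes j≡i = j≡i
... | no _ rewrite dec-true (j ≟ j) refl = refl

P-lower-block : (s k : ℕ) {r : ℕ} (τ : Thresholds r) (a : Fin (suc k)) (n : ℕ) →
  P (suc k + r) (lowerAt (withBlocks s (suc k) τ) (a ↑ˡ r)) n ≡ P (k + suc r) (withBlocks s k ((s ∸ 1) ◂ τ)) n
P-lower-block s k {r} τ a n = begin
    P (suc k + r) (lowerAt t x) n
  ≡⟨ sym (P-permute (Perm.transpose x L) (lowerAt t x) n) ⟩
    P (suc k + r) (lowerAt t x ∘ transpose x L) n
  ≡⟨ P-cong (suc k + r) (λ y → trans (cong (λ z → lowerAt t z (transpose x L y)) (sym (transpose-hits x L)))
                                     (lowerAt-inj (transpose x L) transpose-injective t L y)) n ⟩
    P (suc k + r) (lowerAt (t ∘ transpose x L) L) n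
  ≡⟨ P-cong (suc k + r) (λ y → cong (λ u → if does (L ≟ y) then u ∸ 1 else u) (t-fixed y)) n ⟩
    P (suc k + r) (lowerAt t L) n
  ≡⟨ sym (P-permute (Perm.cast-id (+-suc k r)) (lowerAt t L) n) ⟩
    P (k + suc r) (lowerAt t L ∘ cast (+-suc k r)) n
  ≡⟨ P-cong (k + suc r) (lower-last k τ (+-suc k r)) n ⟩
    P (k + suc r) (withBlocks s k ((s ∸ 1) ◂ τ)) n ∎
  where
  open ≡-Reasoning
  t = withBlocks s (suc k) τ
  x = a ↑ˡ r
  L = fromℕ k ↑ˡ r
  t-fixed : ∀ y → t (transpose x L y) ≡ t y
  t-fixed = transpose-fixes t x L (trans (withBlocks-↑ˡ s (suc k) τ a) (sym (withBlocks-↑ˡ s (suc k) τ (fromℕ k))))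
  transpose-injective : ∀ {y z} → transpose x L y ≡ transpose x L z → y ≡ z
  transpose-injective {y} {z} e =
    trans (sym (transpose-inverse L x)) (trans (cong (transpose L x) e) (transpose-inverse L x))
  lower-last : (k : ℕ) {r : ℕ} (τ : Thresholds r) .(eq : k + suc r ≡ suc k + r) →
    ∀ y → lowerAt (withBlocks s (suc k) τ) (fromℕ k ↑ˡ r) (cast eq y) ≡ withBlocks s k ((s ∸ 1) ◂ τ) y
  lower-last zero    τ eq fz     = refl
  lower-last zero    τ eq (fs y) = cong τ (cast-is-id _ y)
  lower-last (suc k) τ eq fz     = refl
  lower-last (suc k) τ eq (fs y) = lower-last k τ (suc-injective eq) y

P-vanish : (M : ℕ) (t : Thresholds M) (n : ℕ) → n < sum t → P M t n ≡ 0
P-vanish (suc M) t n n<∑t = conv-vanish _ _ (t fz) (sum (t ∘ fs)) n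
  (λ i i<t0 → cong ind (dec-false (t fz ≤? i) (<⇒≱ i<t0)))
  (λ j j<∑ → P-vanish M (t ∘ fs) j j<∑) n<∑t

_/!_ : ℕ → ℕ → ℚ
a /! n = ((ℤ.+ a) / (n !)) {{n !≢0}}

private
  normalise : (a d : ℕ) .{{_ : NonZero d}} → toℚᵘ ((ℤ.+ a) / d) ≃ᵘ mkℚᵘ (ℤ.+ a) (ℕ.pred d)
  normalise a (suc d) = ℚ.toℚᵘ-fromℚᵘ (mkℚᵘ (ℤ.+ a) d)

/-cross : (a b c e : ℕ) .{{_ : NonZero b}} .{{_ : NonZero e}} → a * e ≡ c * b → (ℤ.+ a) / b ≡ (ℤ.+ c) / e
/-cross a (suc b) c (suc e) ae≡cb = ℚ.fromℚᵘ-cong {mkℚᵘ (ℤ.+ a) b} {mkℚᵘ (ℤ.+ c) e}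
  (*≡* (trans (sym (ℤ.pos-* a (suc e))) (trans (cong ℤ.+_ ae≡cb) (ℤ.pos-* c (suc b)))))

/-+ : (a c d : ℕ) .{{_ : NonZero d}} → ((ℤ.+ a) / d) +ℚ ((ℤ.+ c) / d) ≡ (ℤ.+ (a + c)) / d
/-+ a c (suc d) = ℚ.toℚᵘ-injective (ℚᵘ.≃-trans (ℚ.toℚᵘ-homo-+ ((ℤ.+ a) / suc d) ((ℤ.+ c) / suc d))
  (ℚᵘ.≃-trans (ℚᵘ.+-cong (normalise a (suc d)) (normalise c (suc d)))
  (ℚᵘ.≃-trans (*≡* numerators) (ℚᵘ.≃-sym (normalise (a + c) (suc d))))))
  where
  D = suc d
  numerators : (ℤ.+ a ℤ.* ℤ.+ D ℤ.+ ℤ.+ c ℤ.* ℤ.+ D) ℤ.* ℤ.+ D ≡ ℤ.+ (a + c) ℤ.* ℤ.+ (D * D)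
  numerators = begin
      (ℤ.+ a ℤ.* ℤ.+ D ℤ.+ ℤ.+ c ℤ.* ℤ.+ D) ℤ.* ℤ.+ D
    ≡⟨ cong (ℤ._* ℤ.+ D) (cong₂ ℤ._+_ (sym (ℤ.pos-* a D)) (sym (ℤ.pos-* c D))) ⟩
      (ℤ.+ (a * D) ℤ.+ ℤ.+ (c * D)) ℤ.* ℤ.+ D
    ≡⟨ sym (trans (ℤ.pos-* (a * D + c * D) D) (cong (ℤ._* ℤ.+ D) (ℤ.pos-+ (a * D) (c * D)))) ⟩
      ℤ.+ ((a * D + c * D) * D)
    ≡⟨ cong ℤ.+_ (trans (cong (_* D) (sym (*-distribʳ-+ D a c))) (*-assoc (a + c) D D)) ⟩
      ℤ.+ ((a + c) * (D * D))
    ≡⟨ ℤ.pos-* (a + c) (D * D) ⟩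
      ℤ.+ (a + c) ℤ.* ℤ.+ (D * D) ∎
    where open ≡-Reasoning

/-* : (a b c e : ℕ) .{{_ : NonZero b}} .{{_ : NonZero e}} →
  ((ℤ.+ a) / b) *ℚ ((ℤ.+ c) / e) ≡ ((ℤ.+ (a * c)) / (b * e)) {{m*n≢0 b e}}
/-* a (suc b) c (suc e) = ℚ.toℚᵘ-injective (ℚᵘ.≃-trans (ℚ.toℚᵘ-homo-* ((ℤ.+ a) / suc b) ((ℤ.+ c) / suc e))
  (ℚᵘ.≃-trans (ℚᵘ.*-cong (normalise a (suc b)) (normalise c (suc e)))
  (ℚᵘ.≃-trans (*≡* (cong (ℤ._* ℤ.+ (suc b * suc e)) (sym (ℤ.pos-* a c))))
              (ℚᵘ.≃-sym (normalise (a * c) (suc b * suc e) {{m*n≢0 (suc b) (suc e)}})))))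

/!-zero : (n : ℕ) → 0 /! n ≡ 0ℚ
/!-zero n = ℚ.0/n≡0 (n !) {{n !≢0}}

choose-factorials : (n i : ℕ) → i ≤ n → (n C i) * (i ! * (n ∸ i) !) ≡ n !
choose-factorials n i i≤n = trans (cong (_* (i ! * (n ∸ i) !)) (nCk≡n!/k![n-k]! i≤n))
  (m/n*n≡m {{i !* (n ∸ i) !≢0}} (k![n∸k]!∣n! i≤n))

sumℚ-/! : (m n : ℕ) (h : ℕ → ℕ) → sumℚ m (λ i → h i /! n) ≡ (∑[ i < m ] h (toℕ i)) /! n
sumℚ-/! zero    n h = sym (/!-zero n)
sumℚ-/! (suc m) n h = begin
    sumℚ m (λ i → h i /! n) +ℚ h m /! n
  ≡⟨ cong (_+ℚ h m /! n) (sumℚ-/! m n h) ⟩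
    (∑[ i < m ] h (toℕ i)) /! n +ℚ h m /! n
  ≡⟨ /-+ (∑[ i < m ] h (toℕ i)) (h m) (n !) {{n !≢0}} ⟩
    (∑[ i < m ] h (toℕ i) + h m) /! n
  ≡⟨ cong (_/! n) (sym (trans (sum-init-last {m} (h ∘ toℕ))
                              (cong₂ _+_ (sum-cong-≗ {m} (cong h ∘ toℕ-inject₁)) (cong h (toℕ-fromℕ m))))) ⟩
    (∑[ i < suc m ] h (toℕ i)) /! n ∎
  where open ≡-Reasoning

⊛-conv : (F G : FPS) (X Y : ℕ → ℕ) → (∀ i → F i ≡ X i /! i) → (∀ i → G i ≡ Y i /! i) →
  ∀ n → (F ⊛ G) n ≡ conv X Y n /! n
⊛-conv F G X Y F≡X G≡Y n = trans (sumℚ-cong (suc n) term) (sumℚ-/! (suc n) n (λ i → (n C i) * X i * Y (n ∸ i)))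
  where
  sumℚ-cong : (m : ℕ) {f g : ℕ → ℚ} → (∀ i → i < m → f i ≡ g i) → sumℚ m f ≡ sumℚ m g
  sumℚ-cong zero    f≡g = refl
  sumℚ-cong (suc m) f≡g = cong₂ _+ℚ_ (sumℚ-cong m (λ i i<m → f≡g i (m<n⇒m<1+n i<m))) (f≡g m (n<1+n m))
  term : ∀ i → i < suc n → F i *ℚ G (n ∸ i) ≡ ((n C i) * X i * Y (n ∸ i)) /! n
  term i (s≤s i≤n) = begin
      F i *ℚ G (n ∸ i)
    ≡⟨ cong₂ _*ℚ_ (F≡X i) (G≡Y (n ∸ i)) ⟩
      X i /! i *ℚ Y (n ∸ i) /! (n ∸ i)
    ≡⟨ /-* (X i) (i !) (Y (n ∸ i)) ((n ∸ i) !) {{i !≢0}} {{(n ∸ i) !≢0}} ⟩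
      ((ℤ.+ (X i * Y (n ∸ i))) / (i ! * (n ∸ i) !)) {{i !* (n ∸ i) !≢0}}
    ≡⟨ /-cross (X i * Y (n ∸ i)) (i ! * (n ∸ i) !) ((n C i) * X i * Y (n ∸ i)) (n !)
               {{i !* (n ∸ i) !≢0}} {{n !≢0}} cross ⟩
      ((n C i) * X i * Y (n ∸ i)) /! n ∎
    where
    open ≡-Reasoning
    cross : X i * Y (n ∸ i) * n ! ≡ (n C i) * X i * Y (n ∸ i) * (i ! * (n ∸ i) !)
    cross = trans (cong (X i * Y (n ∸ i) *_) (sym (choose-factorials n i i≤n)))
                  (solve 4 (λ x y c f → x :* y :* (c :* f) := c :* x :* y :* f) refl
                         (X i) (Y (n ∸ i)) (n C i) (i ! * (n ∸ i) !))

expTrunc-below : (t i : ℕ) → i < t → expTrunc t i ≡ invFact i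
expTrunc-above : (t i : ℕ) → t ≤ i → expTrunc t i ≡ 0ℚ

expTrunc-below (suc t) i i<1+t with i <? t
... | yes i<t = trans (cong₂ _+ℚ_ (expTrunc-below t i i<t) (cong (λ b → if b then invFact t else 0ℚ) (dec-false (t ℕ.≟ i) (>⇒≢ i<t))))
                      (ℚ.+-identityʳ (invFact i))
... | no i≮t with refl ← ≤-antisym (s≤s⁻¹ i<1+t) (≮⇒≥ i≮t) =
  trans (cong₂ _+ℚ_ (expTrunc-above i i ≤-refl) (cong (λ b → if b then invFact i else 0ℚ) (dec-true (i ℕ.≟ i) refl)))
        (ℚ.+-identityˡ (invFact i))
expTrunc-above zero    i t≤i = refl
expTrunc-above (suc t) i t<i =
  trans (cong₂ _+ℚ_ (expTrunc-above t i (<⇒≤ t<i)) (cong (λ b → if b then invFact t else 0ℚ) (dec-false (t ℕ.≟ i) (<⇒≢ t<i))))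
        (ℚ.+-identityʳ 0ℚ)

expTail-coeff : (t n : ℕ) → (expS ⊖ expTrunc t) n ≡ atLeast t n /! n
expTail-coeff t n with t ≤? n
... | yes t≤n = begin
    invFact n -ℚ expTrunc t n
  ≡⟨ cong (invFact n -ℚ_) (expTrunc-above t n t≤n) ⟩
    invFact n -ℚ 0ℚ
  ≡⟨ ℚ.+-identityʳ (invFact n) ⟩
    1 /! n
  ≡⟨ cong (λ b → ind b /! n) (sym (dec-true (t ≤? n) t≤n)) ⟩
    atLeast t n /! n ∎
  where open ≡-Reasoning
... | no t≰n = begin
    invFact n -ℚ expTrunc t n
  ≡⟨ cong (invFact n -ℚ_) (expTrunc-below t n (≰⇒> t≰n)) ⟩
    invFact n -ℚ invFact n
  ≡⟨ ℚ.+-inverseʳ (invFact n) ⟩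
    0ℚ
  ≡⟨ sym (/!-zero n) ⟩
    0 /! n
  ≡⟨ cong (λ b → ind b /! n) (sym (dec-false (t ≤? n) t≰n)) ⟩
    atLeast t n /! n ∎
  where open ≡-Reasoning

expTail-pow-coeff : (k t n : ℕ) → ((expS ⊖ expTrunc t) ^S k) n ≡ P k (λ _ → t) n /! n
expTail-pow-coeff zero    t zero    = refl
expTail-pow-coeff zero    t (suc n) = sym (/!-zero (suc n))
expTail-pow-coeff (suc k) t n = ⊛-conv _ _ (atLeast t) (P k (λ _ → t)) (expTail-coeff t) (expTail-pow-coeff k t) n

rhs-coeff : (s r k n : ℕ) →
  rhsS s r k n ≡ invFact k *ℚ conv (P k (λ _ → s)) (P r (λ _ → s ∸ 1)) n /! n
rhs-coeff s r k n = cong (invFact k *ℚ_)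
  (⊛-conv _ _ (P k (λ _ → s)) (P r (λ _ → s ∸ 1)) (expTail-pow-coeff k s) (expTail-pow-coeff r (s ∸ 1)) n)

count : {A : Set} → (A → Bool) → List A → ℕ
count p xs = length (filterᵇ p xs)

sumL : {A : Set} → List A → (A → ℕ) → ℕ
sumL []       f = 0
sumL (x ∷ xs) f = f x + sumL xs f

module _ {A : Set} where

  count-sumL : (p : A → Bool) (xs : List A) → count p xs ≡ sumL xs (ind ∘ p)
  count-sumL p [] = refl
  count-sumL p (x ∷ xs) with p x
  ... | true  = cong suc (count-sumL p xs)
  ... | false = count-sumL p xs

  sumL-cong : (xs : List A) {f g : A → ℕ} → (∀ a → f a ≡ g a) → sumL xs f ≡ sumL xs g
  sumL-cong []       f≡g = refl
  sumL-cong (x ∷ xs) f≡g = cong₂ _+_ (f≡g x) (sumL-cong xs f≡g)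

  count-cong : (xs : List A) {p q : A → Bool} → (∀ a → p a ≡ q a) → count p xs ≡ count q xs
  count-cong xs {p} {q} p≡q = trans (count-sumL p xs) (trans (sumL-cong xs (cong ind ∘ p≡q)) (sym (count-sumL q xs)))

  count-none : (xs : List A) (p : A → Bool) → (∀ a → p a ≡ false) → count p xs ≡ 0
  count-none []       p p≡f = refl
  count-none (x ∷ xs) p p≡f rewrite p≡f x = count-none xs p p≡f

  sumL-++ : (xs ys : List A) (f : A → ℕ) → sumL (xs ++ ys) f ≡ sumL xs f + sumL ys f
  sumL-++ []       ys f = refl
  sumL-++ (x ∷ xs) ys f = trans (cong (f x +_) (sumL-++ xs ys f)) (sym (+-assoc (f x) _ _))

  sumL-+ : (xs : List A) (f g : A → ℕ) → sumL xs (λ a → f a + g a) ≡ sumL xs f + sumL xs g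
  sumL-+ []       f g = refl
  sumL-+ (x ∷ xs) f g rewrite sumL-+ xs f g = +-exchange (f x) (g x) (sumL xs f) (sumL xs g)
    where
    +-exchange : ∀ a b c d → a + b + (c + d) ≡ a + c + (b + d)
    +-exchange a b c d = solve 4 (λ a b c d → a :+ b :+ (c :+ d) := a :+ c :+ (b :+ d)) refl a b c d

  sumL-*ˡ : (c : ℕ) (xs : List A) (f : A → ℕ) → sumL xs (λ a → c * f a) ≡ c * sumL xs f
  sumL-*ˡ c []       f = sym (*-zeroʳ c)
  sumL-*ˡ c (x ∷ xs) f = trans (cong (c * f x +_) (sumL-*ˡ c xs f)) (sym (*-distribˡ-+ c (f x) _))

module _ {A B : Set} where

  sumL-map : (g : A → B) (xs : List A) (f : B → ℕ) → sumL (map g xs) f ≡ sumL xs (f ∘ g)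
  sumL-map g []       f = refl
  sumL-map g (x ∷ xs) f = cong (f (g x) +_) (sumL-map g xs f)

  sumL-concatMap : (g : A → List B) (xs : List A) (f : B → ℕ) → sumL (concatMap g xs) f ≡ sumL xs (λ a → sumL (g a) f)
  sumL-concatMap g []       f = refl
  sumL-concatMap g (x ∷ xs) f = trans (sumL-++ (g x) (concatMap g xs) f) (cong (sumL (g x) f +_) (sumL-concatMap g xs f))

  sumL-swap : (xs : List A) (ys : List B) (f : A → B → ℕ) →
    sumL xs (λ a → sumL ys (f a)) ≡ sumL ys (λ b → sumL xs (λ a → f a b))
  sumL-swap []       ys f = sym (sumL-*ˡ 0 ys (λ _ → 0))
  sumL-swap (x ∷ xs) ys f = trans (cong (sumL ys (f x) +_) (sumL-swap xs ys f)) (sym (sumL-+ ys (f x) (λ b → sumL xs (λ a → f a b))))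

sumL-tabulate : {B : Set} {m : ℕ} (h : Fin m → B) (f : B → ℕ) → sumL (tabulate h) f ≡ sum (f ∘ h)
sumL-tabulate {m = zero}  h f = refl
sumL-tabulate {m = suc m} h f = cong (f (h fz) +_) (sumL-tabulate (h ∘ fs) f)

count-allFin : {m : ℕ} (p : Fin m → Bool) → count p (allFin m) ≡ ∑[ i < m ] ind (p i)
count-allFin p = trans (count-sumL p (allFin _)) (sumL-tabulate id (ind ∘ p))

∑-point : {m : ℕ} (a : Fin m) → ∑[ x < m ] ind (does (x Fin.≟ a)) ≡ 1
∑-point {suc m} fz     = cong suc (sum-zero {m} (λ x → ind (does (fs x Fin.≟ fz))) (λ _ → refl))
∑-point {suc m} (fs a) = ∑-point a

record Enumeration (S : DecSetoid 0ℓ 0ℓ) : Set where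
  open DecSetoid S using (Carrier) renaming (_≟_ to _≈?_)
  field
    list         : List Carrier
    exactly-once : ∀ a → count (λ x → does (x ≈? a)) list ≡ 1
open Enumeration public

record Correspondence (S T : DecSetoid 0ℓ 0ℓ) (P : DecSetoid.Carrier S → Set) (Q : DecSetoid.Carrier T → Set) : Set where
  private
    module S = DecSetoid S
    module T = DecSetoid T
  field
    to        : S.Carrier → T.Carrier
    from      : T.Carrier → S.Carrier
    to-cong   : ∀ {a a'} → a S.≈ a' → to a T.≈ to a'
    from-cong : ∀ {b b'} → b T.≈ b' → from b S.≈ from b'
    P-resp    : ∀ {a a'} → a S.≈ a' → P a → P a'
    Q-resp    : ∀ {b b'} → b T.≈ b' → Q b → Q b'
    to-ok     : ∀ {a} → P a → Q (to a)
    from-ok   : ∀ {b} → Q b → P (from b)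
    from-to   : ∀ {a} → P a → from (to a) S.≈ a
    to-from   : ∀ {b} → Q b → to (from b) T.≈ b

select : {T : DecSetoid 0ℓ 0ℓ} (E : Enumeration T) (c : Bool) (y : DecSetoid.Carrier T) →
  sumL (list E) (λ b → ind (c ∧ does (DecSetoid._≟_ T b y))) ≡ ind c
select {T} E c y = begin
    sumL ys (λ b → ind (c ∧ does (b ≈? y)))
  ≡⟨ sumL-cong ys (λ b → ind-∧ c (does (b ≈? y))) ⟩
    sumL ys (λ b → ind c * ind (does (b ≈? y)))
  ≡⟨ sumL-*ˡ (ind c) ys (λ b → ind (does (b ≈? y))) ⟩
    ind c * sumL ys (λ b → ind (does (b ≈? y)))
  ≡⟨ cong (ind c *_) (trans (sym (count-sumL (λ b → does (b ≈? y)) ys)) (exactly-once E y)) ⟩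
    ind c * 1
  ≡⟨ *-identityʳ (ind c) ⟩
    ind c ∎
  where
  open ≡-Reasoning
  open DecSetoid T using () renaming (_≟_ to _≈?_)
  ys = list E

-- Double counting the pairs (a, b) with P a and b ≈ to a, equivalently Q b and a ≈ from b.
count-correspondence : {S T : DecSetoid 0ℓ 0ℓ} {P : DecSetoid.Carrier S → Set} {Q : DecSetoid.Carrier T → Set}
  (P? : ∀ a → Dec (P a)) (Q? : ∀ b → Dec (Q b)) (E : Enumeration S) (F : Enumeration T) →
  Correspondence S T P Q → count (does ∘ P?) (list E) ≡ count (does ∘ Q?) (list F)
count-correspondence {S} {T} {P} {Q} P? Q? E F corr = begin
    count (does ∘ P?) xs
  ≡⟨ count-sumL _ xs ⟩
    sumL xs (ind ∘ does ∘ P?)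
  ≡⟨ sumL-cong xs (λ a → sym (select F (does (P? a)) (to a))) ⟩
    sumL xs (λ a → sumL ys (λ b → ind (does (P? a) ∧ does (b T.≟ to a))))
  ≡⟨ sumL-swap xs ys _ ⟩
    sumL ys (λ b → sumL xs (λ a → ind (does (P? a) ∧ does (b T.≟ to a))))
  ≡⟨ sumL-cong ys (λ b → sumL-cong xs (λ a → cong ind (pairing a b))) ⟩
    sumL ys (λ b → sumL xs (λ a → ind (does (Q? b) ∧ does (a S.≟ from b))))
  ≡⟨ sumL-cong ys (λ b → select E (does (Q? b)) (from b)) ⟩
    sumL ys (ind ∘ does ∘ Q?)
  ≡⟨ sym (count-sumL _ ys) ⟩
    count (does ∘ Q?) ys ∎
  where
  open ≡-Reasoning
  module S = DecSetoid S
  module T = DecSetoid T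
  open Correspondence corr
  xs = list E
  ys = list F
  pairing : ∀ a b → (does (P? a) ∧ does (b T.≟ to a)) ≡ (does (Q? b) ∧ does (a S.≟ from b))
  pairing a b = bool-ext forward backward
    where
    forward : (does (P? a) ∧ does (b T.≟ to a)) ≡ true → (does (Q? b) ∧ does (a S.≟ from b)) ≡ true
    forward h = ∧-intro (dec-true (Q? b) (Q-resp (T.sym b≈ta) (to-ok Pa)))
                        (dec-true (a S.≟ from b) (S.trans (S.sym (from-to Pa)) (from-cong (T.sym b≈ta))))
      where
      Pa = witness (P? a) (∧-elimˡ h)
      b≈ta = witness (b T.≟ to a) (∧-elimʳ h)
    backward : (does (Q? b) ∧ does (a S.≟ from b)) ≡ true → (does (P? a) ∧ does (b T.≟ to a)) ≡ true
    backward h = ∧-intro (dec-true (P? a) (P-resp (S.sym a≈fb) (from-ok Qb)))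
                         (dec-true (b T.≟ to a) (T.trans (T.sym (to-from Qb)) (to-cong (S.sym a≈fb))))
      where
      Qb = witness (Q? b) (∧-elimˡ h)
      a≈fb = witness (a S.≟ from b) (∧-elimʳ h)

FinS : ℕ → DecSetoid 0ℓ 0ℓ
FinS = Fin-decSetoid

allFin-enumeration : (m : ℕ) → Enumeration (FinS m)
allFin-enumeration m = record
  { list = allFin m
  ; exactly-once = λ a → trans (count-allFin (λ x → does (x Fin.≟ a))) (∑-point a) }

booleans : Enumeration Bool.≡-decSetoid
booleans = record { list = true ∷ false ∷ [] ; exactly-once = λ { true → refl ; false → refl } }

FunS : DecSetoid 0ℓ 0ℓ → ℕ → DecSetoid 0ℓ 0ℓ
FunS = Pointwise.decSetoid

sumL-allFuns-suc : {A : Set} (xs : List A) (n : ℕ) (F : (Fin (suc n) → A) → ℕ) →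
  (∀ {h h'} → (∀ i → h i ≡ h' i) → F h ≡ F h') →
  sumL (allFuns xs (suc n)) F ≡ sumL xs (λ a → sumL (allFuns xs n) (λ f → F (a ◂ f)))
sumL-allFuns-suc xs n F F-ext = trans (sumL-concatMap _ xs F)
  (sumL-cong xs (λ a → trans (sumL-map _ (allFuns xs n) F)
                             (sumL-cong (allFuns xs n) (λ f → F-ext (λ { fz → refl ; (fs i) → refl })))))

allFuns-once : {S : DecSetoid 0ℓ 0ℓ} (E : Enumeration S) (n : ℕ) (g : Fin n → DecSetoid.Carrier S) →
  count (λ f → does (DecSetoid._≟_ (FunS S n) f g)) (allFuns (list E) n) ≡ 1
allFuns-once {S} E zero g = cong (λ b → ind b + 0) (does-≡ (f₀ ≟ₙ g) (yes λ ()))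
  where
  open DecSetoid (FunS S zero) renaming (_≟_ to _≟ₙ_)
  f₀ = λ ()
allFuns-once {S} E (suc n) g = begin
    count (λ f → does (f ≟ₙ g)) (allFuns xs (suc n))
  ≡⟨ count-sumL _ (allFuns xs (suc n)) ⟩
    sumL (allFuns xs (suc n)) (λ f → ind (does (f ≟ₙ g)))
  ≡⟨ sumL-allFuns-suc xs n _ (λ h≗h' → cong ind (does-resp h≗h')) ⟩
    sumL xs (λ a → sumL (allFuns xs n) (λ f → ind (does ((a ◂ f) ≟ₙ g))))
  ≡⟨ sumL-cong xs (λ a → trans (sumL-cong (allFuns xs n) (λ f → cong ind (split a f)))
                               (select {FunS S n} (record { list = allFuns xs n ; exactly-once = allFuns-once E n }) (does (a ≈? g fz)) (g ∘ fs))) ⟩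
    sumL xs (λ a → ind (does (a ≈? g fz)))
  ≡⟨ trans (sym (count-sumL _ xs)) (exactly-once E (g fz)) ⟩
    1 ∎
  where
  open ≡-Reasoning
  open DecSetoid S using (_≈_) renaming (_≟_ to _≈?_)
  xs = list E
  open DecSetoid (FunS S (suc n)) using () renaming (_≟_ to _≟ₙ_)
  open DecSetoid (FunS S n) using () renaming (_≟_ to _≟ᵣ_)
  does-resp : ∀ {h h'} → (∀ i → h i ≡ h' i) → does (h ≟ₙ g) ≡ does (h' ≟ₙ g)
  does-resp {h} {h'} h≗h' = does-≡ (h ≟ₙ g)
    (map′ (λ e i → subst (_≈ g i) (sym (h≗h' i)) (e i)) (λ e i → subst (_≈ g i) (h≗h' i) (e i)) (h' ≟ₙ g))
  split : ∀ a f → does ((a ◂ f) ≟ₙ g) ≡ (does (a ≈? g fz) ∧ does (f ≟ᵣ (g ∘ fs)))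
  split a f = does-≡ ((a ◂ f) ≟ₙ g)
    (map′ (λ { (e₀ , e) → λ { fz → e₀ ; (fs i) → e i } }) (λ e → e fz , e ∘ fs)
          (a ≈? g fz ×-dec f ≟ᵣ (g ∘ fs)))

pairs : {A B : Set} → List A → List B → List (A × B)
pairs xs ys = concatMap (λ a → map (a ,_) ys) xs

allFuns-enumeration : {S : DecSetoid 0ℓ 0ℓ} → Enumeration S → (n : ℕ) → Enumeration (FunS S n)
allFuns-enumeration E n = record { list = allFuns (list E) n ; exactly-once = allFuns-once E n }

sumL-pairs : {A B : Set} (xs : List A) (ys : List B) (f : A × B → ℕ) →
  sumL (pairs xs ys) f ≡ sumL xs (λ a → sumL ys (λ b → f (a , b)))
sumL-pairs xs ys f = trans (sumL-concatMap _ xs f) (sumL-cong xs (λ a → sumL-map (a ,_) ys f))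

pairs-enumeration : {S T : DecSetoid 0ℓ 0ℓ} → Enumeration S → Enumeration T → Enumeration (×-decSetoid S T)
pairs-enumeration {S} {T} E F = record { list = pairs (list E) (list F) ; exactly-once = once }
  where
  module S = DecSetoid S
  module T = DecSetoid T
  xs = list E
  ys = list F
  once : ∀ p → count (λ q → does (proj₁ q S.≟ proj₁ p) ∧ does (proj₂ q T.≟ proj₂ p)) (pairs xs ys) ≡ 1
  once (a , b) = begin
      count (λ p → does (proj₁ p S.≟ a) ∧ does (proj₂ p T.≟ b)) (pairs xs ys)
    ≡⟨ count-sumL _ (pairs xs ys) ⟩
      sumL (pairs xs ys) (λ p → ind (does (proj₁ p S.≟ a) ∧ does (proj₂ p T.≟ b)))
    ≡⟨ sumL-pairs xs ys _ ⟩
      sumL xs (λ x → sumL ys (λ y → ind (does (x S.≟ a) ∧ does (y T.≟ b))))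
    ≡⟨ sumL-cong xs (λ x → select F (does (x S.≟ a)) b) ⟩
      sumL xs (λ x → ind (does (x S.≟ a)))
    ≡⟨ trans (sym (count-sumL _ xs)) (exactly-once E a) ⟩
      1 ∎
    where open ≡-Reasoning

Rel : ℕ → Set
Rel n = Fin n → Fin n → Bool

RelS : ℕ → DecSetoid 0ℓ 0ℓ
RelS n = FunS (FunS Bool.≡-decSetoid n) n

relations : (n : ℕ) → Enumeration (RelS n)
relations n = allFuns-enumeration (allFuns-enumeration booleans n) n

allᶠ : (m : ℕ) → (Fin m → Bool) → Bool
allᶠ zero    p = true
allᶠ (suc m) p = p fz ∧ allᶠ m (p ∘ fs)

allᶠ-intro : (m : ℕ) {p : Fin m → Bool} → (∀ i → p i ≡ true) → allᶠ m p ≡ true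
allᶠ-intro zero    p≡t = refl
allᶠ-intro (suc m) p≡t = ∧-intro (p≡t fz) (allᶠ-intro m (p≡t ∘ fs))

allᶠ-elim : (m : ℕ) {p : Fin m → Bool} → allᶠ m p ≡ true → ∀ i → p i ≡ true
allᶠ-elim (suc m) h fz     = ∧-elimˡ h
allᶠ-elim (suc m) h (fs i) = allᶠ-elim m (∧-elimʳ h) i

allᶠ-cong : (m : ℕ) {p q : Fin m → Bool} → (∀ i → p i ≡ q i) → allᶠ m p ≡ allᶠ m q
allᶠ-cong zero    p≡q = refl
allᶠ-cong (suc m) p≡q = cong₂ _∧_ (p≡q fz) (allᶠ-cong m (p≡q ∘ fs))

isLeast : {n : ℕ} → Rel n → Fin n → Bool
isLeast {n} R i = allᶠ n (λ j → (toℕ j <ᵇ toℕ i) ⇒ᵇ not (R j i))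

blockSize : {n : ℕ} → Rel n → Fin n → ℕ
blockSize R i = sum (λ j → ind (R i j))

-- A labelling gives each element either label zero ("unlabelled") or a label suc l, l : Fin r.
Labelling : ℕ → ℕ → Set
Labelling n r = Fin n → Fin (suc r)

unlabelled : {r : ℕ} → Fin (suc r) → Bool
unlabelled fz     = true
unlabelled (fs _) = false

labelSize : {n r : ℕ} → Labelling n r → Fin r → ℕ
labelSize c l = sum (λ i → ind (does (c i ≟ fs l)))

unlabelledBlocks : {n r : ℕ} → Labelling n r → Rel n → ℕ
unlabelledBlocks c R = sum (λ i → ind (unlabelled (c i) ∧ isLeast R i))

record LabelledPartition (s : ℕ) {n r : ℕ} (τ : Thresholds r) (k : ℕ) (c : Labelling n r) (R : Rel n) : Set where
  field
    only-unlabelled : ∀ i j → R i j ≡ true → c i ≡ fz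
    reflexive       : ∀ i → c i ≡ fz → R i i ≡ true
    symmetric       : ∀ i j → R i j ≡ true → R j i ≡ true
    transitive      : ∀ i j l → R i j ≡ true → R j l ≡ true → R i l ≡ true
    block-count     : unlabelledBlocks c R ≡ k
    block-size      : ∀ i → c i ≡ fz → s ≤ blockSize R i
    label-size      : ∀ l → τ l ≤ labelSize c l

labelledPartition? : (s : ℕ) {n r : ℕ} (τ : Thresholds r) (k : ℕ) (c : Labelling n r) (R : Rel n) →
  Dec (LabelledPartition s τ k c R)
labelledPartition? s τ k c R = map′
  (λ (p₁ , p₂ , p₃ , p₄ , p₅ , p₆ , p₇) → record
    { only-unlabelled = p₁ ; reflexive = p₂ ; symmetric = p₃ ; transitive = p₄
    ; block-count = p₅ ; block-size = p₆ ; label-size = p₇ })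
  (λ p → let open LabelledPartition p in
    only-unlabelled , reflexive , symmetric , transitive , block-count , block-size , label-size)
  (all? (λ i → all? (λ j → (R i j Bool.≟ true) →-dec (c i ≟ fz)))
   ×-dec all? (λ i → (c i ≟ fz) →-dec (R i i Bool.≟ true))
   ×-dec all? (λ i → all? (λ j → (R i j Bool.≟ true) →-dec (R j i Bool.≟ true)))
   ×-dec all? (λ i → all? (λ j → all? (λ l → (R i j Bool.≟ true) →-dec ((R j l Bool.≟ true) →-dec (R i l Bool.≟ true)))))
   ×-dec (unlabelledBlocks c R ℕ.≟ k)
   ×-dec all? (λ i → (c i ≟ fz) →-dec (s ≤? blockSize R i))
   ×-dec all? (λ l → τ l ≤? labelSize c l))

module _ {n : ℕ} {R R' : Rel n} (R≗R' : ∀ i j → R i j ≡ R' i j) where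

  isLeast-cong : ∀ i → isLeast R i ≡ isLeast R' i
  isLeast-cong i = allᶠ-cong n (λ j → cong (λ b → (toℕ j <ᵇ toℕ i) ⇒ᵇ not b) (R≗R' j i))

  blockSize-cong : ∀ i → blockSize R i ≡ blockSize R' i
  blockSize-cong i = sum-cong-≗ (λ j → cong ind (R≗R' i j))

module _ {n r : ℕ} {c c' : Labelling n r} {R R' : Rel n} (c≗c' : ∀ i → c i ≡ c' i) (R≗R' : ∀ i j → R i j ≡ R' i j) where

  unlabelledBlocks-cong : unlabelledBlocks c R ≡ unlabelledBlocks c' R'
  unlabelledBlocks-cong = sum-cong-≗ (λ i → cong ind (cong₂ _∧_ (cong unlabelled (c≗c' i)) (isLeast-cong R≗R' i)))

  labelSize-cong : ∀ l → labelSize c l ≡ labelSize c' l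
  labelSize-cong l = sum-cong-≗ (λ i → cong (λ x → ind (does (x ≟ fs l))) (c≗c' i))

  labelledPartition-resp : {s k : ℕ} {τ : Thresholds r} → LabelledPartition s τ k c R → LabelledPartition s τ k c' R'
  labelledPartition-resp p = record
    { only-unlabelled = λ i j e → trans (sym (c≗c' i)) (only-unlabelled i j (trans (R≗R' i j) e))
    ; reflexive = λ i e → trans (sym (R≗R' i i)) (reflexive i (trans (c≗c' i) e))
    ; symmetric = λ i j e → trans (sym (R≗R' j i)) (symmetric i j (trans (R≗R' i j) e))
    ; transitive = λ i j l e e' → trans (sym (R≗R' i l)) (transitive i j l (trans (R≗R' i j) e) (trans (R≗R' j l) e'))
    ; block-count = trans (sym unlabelledBlocks-cong) block-count
    ; block-size = λ i e → subst (_ ≤_) (blockSize-cong R≗R' i) (block-size i (trans (c≗c' i) e))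
    ; label-size = λ l → subst (_ ≤_) (labelSize-cong l) (label-size l)
    }
    where open LabelledPartition p

ObjS : ℕ → ℕ → ℕ → DecSetoid 0ℓ 0ℓ
ObjS m n r = ×-decSetoid (FunS (FinS (suc r)) m) (RelS n)

objects : (m n r : ℕ) → Enumeration (ObjS m n r)
objects m n r = pairs-enumeration (allFuns-enumeration (allFin-enumeration (suc r)) m) (relations n)

U : (s n r : ℕ) → Thresholds r → ℕ → ℕ
U s n r τ k = count (λ o → does (labelledPartition? s τ k (proj₁ o) (proj₂ o))) (list (objects n n r))

UFirst : (s n r : ℕ) → Thresholds r → ℕ → Fin (suc r) → ℕ
UFirst s n r τ k v = count (λ o → does (labelledPartition? s τ k (v ◂ proj₁ o) (proj₂ o))) (list (objects n (suc n) r))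

U-by-first-label : (s n r : ℕ) (τ : Thresholds r) (k : ℕ) → U s (suc n) r τ k ≡ ∑[ v < suc r ] UFirst s n r τ k v
U-by-first-label s n r τ k = begin
    U s (suc n) r τ k
  ≡⟨ trans (count-sumL _ (list (objects (suc n) (suc n) r))) (sumL-pairs Cs (allRels (suc n)) _) ⟩
    sumL Cs (λ c → sumL (allRels (suc n)) (λ R → valid c R))
  ≡⟨ sumL-allFuns-suc (allFin (suc r)) n _ (λ c≗c' → sumL-cong (allRels (suc n)) (λ R → cong ind (does-resp c≗c' R))) ⟩
    sumL (allFin (suc r)) (λ v → sumL (allFuns (allFin (suc r)) n) (λ c' → sumL (allRels (suc n)) (λ R → valid (v ◂ c') R)))
  ≡⟨ sumL-tabulate (λ v → v) (λ v → sumL (allFuns (allFin (suc r)) n) (λ c' → sumL (allRels (suc n)) (λ R → valid (v ◂ c') R))) ⟩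
    ∑[ v < suc r ] sumL (allFuns (allFin (suc r)) n) (λ c' → sumL (allRels (suc n)) (λ R → valid (v ◂ c') R))
  ≡⟨ sum-cong-≗ {suc r} (λ v → sym (trans (count-sumL _ (list (objects n (suc n) r))) (sumL-pairs (allFuns (allFin (suc r)) n) (allRels (suc n)) (λ o → valid (v ◂ proj₁ o) (proj₂ o))))) ⟩
    ∑[ v < suc r ] UFirst s n r τ k v ∎
  where
  open ≡-Reasoning
  Cs = allFuns (allFin (suc r)) (suc n)
  valid : Labelling (suc n) r → Rel (suc n) → ℕ
  valid c R = ind (does (labelledPartition? s τ k c R))
  does-resp : ∀ {c c'} → (∀ i → c i ≡ c' i) → ∀ R →
    does (labelledPartition? s τ k c R) ≡ does (labelledPartition? s τ k c' R)
  does-resp c≗c' R = does-⇔ (labelledPartition-resp c≗c' (λ _ _ → refl))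
    (labelledPartition-resp (sym ∘ c≗c') (λ _ _ → refl)) (labelledPartition? s τ k _ R) (labelledPartition? s τ k _ R)

record IsPER {A : Set} (R : A → A → Bool) : Set where
  field
    sym′   : ∀ x y → R x y ≡ true → R y x ≡ true
    trans′ : ∀ x y z → R x y ≡ true → R y z ≡ true → R x z ≡ true

∨-PER : {A : Set} {R₁ R₂ : A → A → Bool} → IsPER R₁ → IsPER R₂ →
  (∀ x y z → R₁ x y ≡ true → R₂ y z ≡ true → ⊥) → IsPER (λ x y → R₁ x y ∨ R₂ x y)
∨-PER {R₁ = R₁} {R₂} per₁ per₂ disjoint = record
  { sym′ = λ x y h → ∨-elim {R₁ x y} h (λ h₁ → ∨-introˡ _ (P₁.sym′ x y h₁)) (λ h₂ → ∨-introʳ (R₁ y x) (P₂.sym′ x y h₂))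
  ; trans′ = λ x y z h h' → ∨-elim {R₁ x y} h
      (λ h₁ → ∨-elim {R₁ y z} h' (λ h₁' → ∨-introˡ _ (P₁.trans′ x y z h₁ h₁')) (λ h₂' → ⊥-elim (disjoint x y z h₁ h₂')))
      (λ h₂ → ∨-elim {R₁ y z} h' (λ h₁' → ⊥-elim (disjoint z y x (P₁.sym′ y z h₁') (P₂.sym′ x y h₂)))
                                  (λ h₂' → ∨-introʳ (R₁ x z) (P₂.trans′ x y z h₂ h₂')))
  }
  where
  module P₁ = IsPER per₁
  module P₂ = IsPER per₂

both-PER : {A : Set} (B : A → Bool) → IsPER (λ x y → B x ∧ B y)
both-PER B = record
  { sym′ = λ x y h → ∧-intro (∧-elimʳ {B x} h) (∧-elimˡ {B x} h)
  ; trans′ = λ x y z h h' → ∧-intro (∧-elimˡ {B x} h) (∧-elimʳ {B y} h') }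

lowerAt-≤ : {r : ℕ} (τ : Thresholds r) (a b : Fin r) (m : ℕ) → τ b ≤ ind (does (a ≟ b)) + m → lowerAt τ a b ≤ m
lowerAt-≤ τ a b m h with does (a ≟ b)
... | true  = m≤n+o⇒m∸n≤o (τ b) 1 h
... | false = h

≤-lowerAt : {r : ℕ} (τ : Thresholds r) (a b : Fin r) (m : ℕ) → lowerAt τ a b ≤ m → τ b ≤ ind (does (a ≟ b)) + m
≤-lowerAt τ a b m h with does (a ≟ b)
... | true  = ≤-trans (m≤n+m∸n (τ b) 1) (+-monoʳ-≤ 1 h)
... | false = h

isolate : {n : ℕ} → Rel n → Rel (suc n)
isolate R fz     _      = false
isolate R (fs i) fz     = false
isolate R (fs i) (fs j) = R i j

restrict : {n : ℕ} → Rel (suc n) → Rel n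
restrict R i j = R (fs i) (fs j)

-- First element labelled l: removing it gives a labelled partition of the remaining
-- elements in which label l needs one element less.
module LabelledFirst (s n r : ℕ) (τ : Thresholds r) (k : ℕ) (l : Fin r) where

  module _ {c' : Labelling n r} {R : Rel (suc n)} (p : LabelledPartition s τ k (fs l ◂ c') R) where
    open LabelledPartition p

    first-isolatedʳ : ∀ x → R fz x ≡ false
    first-isolatedʳ x with R fz x in e
    ... | true  = contradiction (only-unlabelled fz x e) λ ()
    ... | false = refl

    first-isolatedˡ : ∀ x → R x fz ≡ false
    first-isolatedˡ x with R x fz in e
    ... | true  = contradiction (trans (sym (symmetric x fz e)) (first-isolatedʳ x)) λ ()
    ... | false = refl

    removed : LabelledPartition s (lowerAt τ l) k c' (restrict R)
    removed = record
      { only-unlabelled = λ i j → only-unlabelled (fs i) (fs j)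
      ; reflexive = λ i → reflexive (fs i)
      ; symmetric = λ i j → symmetric (fs i) (fs j)
      ; transitive = λ i j m → transitive (fs i) (fs j) (fs m)
      ; block-count = trans (sum-cong-≗ (λ i → cong (λ b → ind (unlabelled (c' i) ∧ (not b ∧ isLeast (restrict R) i)))
                                                     (sym (first-isolatedʳ (fs i)))))
                            block-count
      ; block-size = λ i e → subst (s ≤_) (cong (λ b → ind b + blockSize (restrict R) i) (first-isolatedˡ (fs i)))
                                    (block-size (fs i) e)
      ; label-size = λ l' → lowerAt-≤ τ l l' _ (label-size l')
      }

    isolate-restrict : ∀ x y → isolate (restrict R) x y ≡ R x y
    isolate-restrict fz     y      = sym (first-isolatedʳ y)
    isolate-restrict (fs i) fz     = sym (first-isolatedˡ (fs i))
    isolate-restrict (fs i) (fs j) = refl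

  module _ {c : Labelling n r} {R : Rel n} (q : LabelledPartition s (lowerAt τ l) k c R) where
    open LabelledPartition q

    added : LabelledPartition s τ k (fs l ◂ c) (isolate R)
    added = record
      { only-unlabelled = λ { (fs i) (fs j) → only-unlabelled i j }
      ; reflexive = λ { (fs i) → reflexive i }
      ; symmetric = λ { (fs i) (fs j) → symmetric i j }
      ; transitive = λ { (fs i) (fs j) (fs m) → transitive i j m }
      ; block-count = block-count
      ; block-size = λ { (fs i) → block-size i }
      ; label-size = λ l' → ≤-lowerAt τ l l' _ (label-size l')
      }

  correspondence : Correspondence (ObjS n (suc n) r) (ObjS n n r)
    (λ o → LabelledPartition s τ k (fs l ◂ proj₁ o) (proj₂ o))
    (λ o → LabelledPartition s (lowerAt τ l) k (proj₁ o) (proj₂ o))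
  correspondence = record
    { to = λ (c , R) → (c , restrict R)
    ; from = λ (c , R) → (c , isolate R)
    ; to-cong = λ (c≗ , R≗) → c≗ , (λ i j → R≗ (fs i) (fs j))
    ; from-cong = λ (c≗ , R≗) → c≗ , isolate-cong R≗
    ; P-resp = λ (c≗ , R≗) → labelledPartition-resp (λ { fz → refl ; (fs i) → c≗ i }) R≗
    ; Q-resp = λ (c≗ , R≗) → labelledPartition-resp c≗ R≗
    ; to-ok = removed
    ; from-ok = added
    ; from-to = λ p → (λ _ → refl) , isolate-restrict p
    ; to-from = λ _ → (λ _ → refl) , (λ _ _ → refl)
    }
    where
    isolate-cong : ∀ {R R' : Rel n} → (∀ i j → R i j ≡ R' i j) → ∀ x y → isolate R x y ≡ isolate R' x y
    isolate-cong R≗ fz     y      = refl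
    isolate-cong R≗ (fs i) fz     = refl
    isolate-cong R≗ (fs i) (fs j) = R≗ i j

  count-eq : UFirst s n r τ k (fs l) ≡ U s n r (lowerAt τ l) k
  count-eq = count-correspondence (λ o → labelledPartition? s τ k (fs l ◂ proj₁ o) (proj₂ o)) (λ o → labelledPartition? s (lowerAt τ l) k (proj₁ o) (proj₂ o)) (objects n (suc n) r) (objects n n r) correspondence

-- Labels in Fin (2 + r): fz is "unlabelled", NEW is a new label and fs (fs l) is the old label l.
NEW : {r : ℕ} → Fin (suc (suc r))
NEW = fs fz

liftLabel : {r : ℕ} → Fin (suc r) → Fin (suc (suc r))
liftLabel fz     = fz
liftLabel (fs l) = fs (fs l)

dropNew : {r : ℕ} → Fin (suc (suc r)) → Fin (suc r)
dropNew fz          = fz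
dropNew (fs fz)     = fz
dropNew (fs (fs l)) = fs l

dropNew-label : {r : ℕ} (x : Fin (suc (suc r))) (l : Fin r) → does (dropNew x ≟ fs l) ≡ does (x ≟ fs (fs l))
dropNew-label fz          l = refl
dropNew-label (fs fz)     l = refl
dropNew-label (fs (fs m)) l = refl

-- The block of the first element is formed by the elements carrying the new label.
inNew : {n r : ℕ} → Labelling n (suc r) → Fin (suc n) → Bool
inNew c fz     = true
inNew c (fs i) = does (c i ≟ NEW)

joinNew : {n r : ℕ} → Labelling n (suc r) → Rel n → Rel (suc n)
joinNew c R x y = isolate R x y ∨ (inNew c x ∧ inNew c y)

first-unlabelled-blocks : {n r : ℕ} (c' : Labelling n r) (R : Rel (suc n)) →
  unlabelledBlocks (fz ◂ c') R ≡ suc (sum (λ i → ind (unlabelled (c' i) ∧ (not (R fz (fs i)) ∧ isLeast (restrict R) i))))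
first-unlabelled-blocks {n} c' R =
  cong (λ b → ind b + sum (λ i → ind (unlabelled (c' i) ∧ (not (R fz (fs i)) ∧ isLeast (restrict R) i)))) (allᶠ-intro (suc n) (λ _ → refl))

-- First element unlabelled: removing it, the rest of its block becomes the class of a new
-- label NEW with threshold s − 1, and one block fewer remains.
module UnlabelledFirst (s n r : ℕ) (τ : Thresholds r) (k : ℕ) where

  τ⁺ : Thresholds (suc r)
  τ⁺ = (s ∸ 1) ◂ τ

  newLabels : Labelling n r → Rel (suc n) → Labelling n (suc r)
  newLabels c' R i = if R fz (fs i) then NEW else liftLabel (c' i)

  remaining : Rel (suc n) → Rel n
  remaining R i j = R (fs i) (fs j) ∧ not (R fz (fs i))

  module _ {c' : Labelling n r} {R : Rel (suc n)} (p : LabelledPartition s τ (suc k) (fz ◂ c') R) where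
    open LabelledPartition p

    private
      c'' = newLabels c' R
      R'' = remaining R
      N : Fin n → Bool
      N i = R fz (fs i)

    R-sym : ∀ x y → R x y ≡ R y x
    R-sym x y = bool-ext (symmetric x y) (symmetric y x)

    N→unlabelled : ∀ i → N i ≡ true → c' i ≡ fz
    N→unlabelled i e = only-unlabelled (fs i) fz (symmetric fz (fs i) e)

    outside-closed : ∀ i j → N i ≡ false → R (fs j) (fs i) ≡ true → N j ≡ false
    outside-closed i j Ni Rji with N j in Nj
    ... | true  = contradiction (trans (sym (transitive fz (fs j) (fs i) Nj Rji)) Ni) λ ()
    ... | false = refl

    newLabels-NEW : ∀ i → does (c'' i ≟ NEW) ≡ N i
    newLabels-NEW i with N i
    ... | true  = refl
    ... | false with c' i
    ...   | fz   = refl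
    ...   | fs l = refl

    remaining-blocks : unlabelledBlocks c'' R'' ≡ k
    remaining-blocks = suc-injective (trans (cong suc (sum-cong-≗ term)) (trans (sym (first-unlabelled-blocks c' R)) block-count))
      where
      term : ∀ i → ind (unlabelled (c'' i) ∧ isLeast R'' i) ≡ ind (unlabelled (c' i) ∧ (not (N i) ∧ isLeast (restrict R) i))
      term i with N i in Ni
      ... | true  = cong ind (sym (Bool.∧-zeroʳ (unlabelled (c' i))))
      ... | false = cong ind (cong₂ _∧_ (unlabelled-lift (c' i)) (allᶠ-cong n (λ j → cong (λ b → (toℕ j <ᵇ toℕ i) ⇒ᵇ not b) (drop-N j))))
        where
        unlabelled-lift : ∀ x → unlabelled (liftLabel x) ≡ unlabelled x
        unlabelled-lift fz     = refl
        unlabelled-lift (fs l) = refl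
        drop-N : ∀ j → (R (fs j) (fs i) ∧ not (N j)) ≡ R (fs j) (fs i)
        drop-N j with R (fs j) (fs i) in Rji
        ... | true  rewrite outside-closed i j Ni Rji = refl
        ... | false = refl

    outside-unlabelled : ∀ i → not (N i) ≡ true → c' i ≡ fz → c'' i ≡ fz
    outside-unlabelled i Ni c'i rewrite not-true Ni | c'i = refl
    newLabels-fz : ∀ i → c'' i ≡ fz → N i ≡ false × c' i ≡ fz
    newLabels-fz i e with N i | c' i
    ... | false | fz = refl , refl
    remaining-reflexive : ∀ i → c'' i ≡ fz → R'' i i ≡ true
    remaining-reflexive i e with (Ni , c'i) ← newLabels-fz i e = ∧-intro (reflexive (fs i) c'i) (cong not Ni)
    remaining-block-size : ∀ i → c'' i ≡ fz → s ≤ blockSize R'' i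
    remaining-block-size i e with (Ni , c'i) ← newLabels-fz i e = subst (s ≤_) same-size (block-size (fs i) c'i)
      where
      same-size : blockSize R (fs i) ≡ blockSize R'' i
      same-size = cong₂ _+_ (cong ind (trans (R-sym (fs i) fz) Ni))
                            (sum-cong-≗ (λ j → cong ind (sym (trans (cong (λ b → R (fs i) (fs j) ∧ not b) Ni)
                                                                           (Bool.∧-identityʳ (R (fs i) (fs j)))))))
    remaining-label-size : ∀ l → τ⁺ l ≤ labelSize c'' l
    remaining-label-size fz = m≤n+o⇒m∸n≤o s 1 (subst (s ≤_) first-block (block-size fz refl))
      where
      first-block : blockSize R fz ≡ 1 + labelSize c'' fz
      first-block = cong₂ _+_ (cong ind (reflexive fz refl)) (sum-cong-≗ (λ i → cong ind (sym (newLabels-NEW i))))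
    remaining-label-size (fs l) = subst (τ l ≤_) (sum-cong-≗ same-label) (label-size l)
      where
      same-label : ∀ i → ind (does (c' i ≟ fs l)) ≡ ind (does (c'' i ≟ fs (fs l)))
      same-label i with N i in Ni
      ... | true  rewrite N→unlabelled i Ni = refl
      ... | false with c' i
      ...   | fz    = refl
      ...   | fs l' = refl

    removed : LabelledPartition s τ⁺ k c'' R''
    removed = record
      { only-unlabelled = λ i j h → outside-unlabelled i (∧-elimʳ {R (fs i) (fs j)} h) (only-unlabelled (fs i) (fs j) (∧-elimˡ h))
      ; reflexive = remaining-reflexive
      ; symmetric = λ i j h → ∧-intro (symmetric (fs i) (fs j) (∧-elimˡ h))
                                      (cong not (outside-closed i j (not-true (∧-elimʳ {R (fs i) (fs j)} h)) (symmetric (fs i) (fs j) (∧-elimˡ h))))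
      ; transitive = λ i j m h h' → ∧-intro (transitive (fs i) (fs j) (fs m) (∧-elimˡ h) (∧-elimˡ h')) (∧-elimʳ {R (fs i) (fs j)} h)
      ; block-count = remaining-blocks
      ; block-size = remaining-block-size
      ; label-size = remaining-label-size
      }

    restored : ∀ x y → joinNew c'' R'' x y ≡ R x y
    restored fz     fz     = sym (reflexive fz refl)
    restored fz     (fs j) = newLabels-NEW j
    restored (fs i) fz     = trans (cong (false ∨_) (Bool.∧-identityʳ _)) (trans (newLabels-NEW i) (R-sym fz (fs i)))
    restored (fs i) (fs j) rewrite newLabels-NEW i | newLabels-NEW j with N i in Ni
    ... | true  rewrite Bool.∧-zeroʳ (R (fs i) (fs j)) = bool-ext
                          (λ Nj → transitive (fs i) fz (fs j) (symmetric fz (fs i) Ni) Nj)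
                          (λ Rij → transitive fz (fs i) (fs j) Ni Rij)
    ... | false rewrite Bool.∧-identityʳ (R (fs i) (fs j)) = Bool.∨-identityʳ (R (fs i) (fs j))

    relabelled : ∀ i → dropNew (c'' i) ≡ c' i
    relabelled i with N i in Ni
    ... | true  = sym (N→unlabelled i Ni)
    ... | false with c' i
    ...   | fz   = refl
    ...   | fs l = refl

  module _ {c : Labelling n (suc r)} {R : Rel n} (q : LabelledPartition s τ⁺ k c R) where
    open LabelledPartition q

    private
      c₀ : Labelling (suc n) r
      c₀ = fz ◂ (dropNew ∘ c)
      Rq : Rel (suc n)
      Rq = joinNew c R
      N : Fin n → Bool
      N i = does (c i ≟ NEW)

    related→unlabelled : ∀ i j → R i j ≡ true → N i ≡ false
    related→unlabelled i j Rij rewrite only-unlabelled i j Rij = refl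

    isolate-PER : IsPER (isolate R)
    isolate-PER = record
      { sym′ = λ { (fs i) (fs j) → symmetric i j }
      ; trans′ = λ { (fs i) (fs j) (fs m) → transitive i j m } }

    joinNew-PER : IsPER Rq
    joinNew-PER = ∨-PER isolate-PER (both-PER (inNew c)) disjoint
      where
      disjoint : ∀ x y z → isolate R x y ≡ true → (inNew c y ∧ inNew c z) ≡ true → ⊥
      disjoint (fs i) (fs j) z Rij Nj =
        contradiction (trans (sym (∧-elimˡ {N j} Nj)) (related→unlabelled j i (symmetric i j Rij))) λ ()

    joined-only-unlabelled : ∀ x y → Rq x y ≡ true → c₀ x ≡ fz
    joined-only-unlabelled fz y h = refl
    joined-only-unlabelled (fs i) y h with c i in ci
    ... | fz    = refl
    ... | fs fz                                        = refl
    joined-only-unlabelled (fs i) fz     h | fs (fs l) = contradiction h λ ()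
    joined-only-unlabelled (fs i) (fs j) h | fs (fs l) =
      ∨-elim {R i j} h (λ Rij → contradiction (trans (sym ci) (only-unlabelled i j Rij)) λ ()) (λ ())
    joined-reflexive : ∀ x → c₀ x ≡ fz → Rq x x ≡ true
    joined-reflexive fz _ = refl
    joined-reflexive (fs i) e with c i in ci
    ... | fz    = ∨-introˡ _ (reflexive i ci)
    ... | fs fz = ∨-introʳ (R i i) refl
    joined-leasts : ∀ i → ind (unlabelled (dropNew (c i)) ∧ (not (N i) ∧ isLeast (restrict Rq) i)) ≡ ind (unlabelled (c i) ∧ isLeast R i)
    joined-leasts i with c i in ci
    ... | fz          = cong ind (allᶠ-cong n (λ j → cong (λ b → (toℕ j <ᵇ toℕ i) ⇒ᵇ not b)
                          (trans (cong (R j i ∨_) (Bool.∧-zeroʳ (N j))) (Bool.∨-identityʳ (R j i)))))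
    ... | fs fz       = refl
    ... | fs (fs l)   = refl
    joined-block-size : ∀ x → c₀ x ≡ fz → s ≤ blockSize Rq x
    joined-block-size fz _ = ≤-trans (m≤n+m∸n s 1) (+-monoʳ-≤ 1 (label-size fz))
    joined-block-size (fs i) e with c i in ci
    ... | fz    = subst (s ≤_) (sum-cong-≗ (λ j → cong ind (sym (Bool.∨-identityʳ (R i j))))) (block-size i ci)
    ... | fs fz = subst (s ≤_) (cong suc (sum-cong-≗ same)) (joined-block-size fz refl)
      where
      same : ∀ j → ind (does (c j ≟ NEW)) ≡ ind (R i j ∨ does (c j ≟ NEW))
      same j with R i j in Rij
      ... | true  = contradiction (trans (sym ci) (only-unlabelled i j Rij)) λ ()
      ... | false = refl

    joined : LabelledPartition s τ (suc k) c₀ Rq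
    joined = record
      { only-unlabelled = joined-only-unlabelled
      ; reflexive = joined-reflexive
      ; symmetric = IsPER.sym′ joinNew-PER
      ; transitive = IsPER.trans′ joinNew-PER
      ; block-count = trans (first-unlabelled-blocks (dropNew ∘ c) Rq) (cong suc (trans (sum-cong-≗ joined-leasts) block-count))
      ; block-size = joined-block-size
      ; label-size = λ l → subst (τ l ≤_) (sum-cong-≗ (λ i → cong ind (sym (dropNew-label (c i) l)))) (label-size (fs l))
      }

    relabel-back : ∀ i → newLabels (dropNew ∘ c) Rq i ≡ c i
    relabel-back i with c i
    ... | fz        = refl
    ... | fs fz     = refl
    ... | fs (fs l) = refl

    remaining-back : ∀ i j → remaining Rq i j ≡ R i j
    remaining-back i j with c i in ci
    ... | fz        = trans (Bool.∧-identityʳ _) (Bool.∨-identityʳ (R i j))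
    ... | fs (fs l) = trans (Bool.∧-identityʳ _) (Bool.∨-identityʳ (R i j))
    ... | fs fz with R i j in Rij
    ...   | true  = contradiction (trans (sym ci) (only-unlabelled i j Rij)) λ ()
    ...   | false = Bool.∧-zeroʳ _

  correspondence : Correspondence (ObjS n (suc n) r) (ObjS n n (suc r))
    (λ o → LabelledPartition s τ (suc k) (fz ◂ proj₁ o) (proj₂ o))
    (λ o → LabelledPartition s τ⁺ k (proj₁ o) (proj₂ o))
  correspondence = record
    { to = λ (c , R) → (newLabels c R , remaining R)
    ; from = λ (c , R) → (dropNew ∘ c , joinNew c R)
    ; to-cong = λ (c≗ , R≗) → (λ i → cong₂ (λ b x → if b then NEW else liftLabel x) (R≗ fz (fs i)) (c≗ i))
                            , (λ i j → cong₂ (λ a b → a ∧ not b) (R≗ (fs i) (fs j)) (R≗ fz (fs i)))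
    ; from-cong = λ (c≗ , R≗) → (λ i → cong dropNew (c≗ i)) , joinNew-cong c≗ R≗
    ; P-resp = λ (c≗ , R≗) → labelledPartition-resp (λ { fz → refl ; (fs i) → c≗ i }) R≗
    ; Q-resp = λ (c≗ , R≗) → labelledPartition-resp c≗ R≗
    ; to-ok = removed
    ; from-ok = joined
    ; from-to = λ p → relabelled p , restored p
    ; to-from = λ q → relabel-back q , remaining-back q
    }
    where
    joinNew-cong : ∀ {c c' : Labelling n (suc r)} {R R' : Rel n} → (∀ i → c i ≡ c' i) → (∀ i j → R i j ≡ R' i j) →
      ∀ x y → joinNew c R x y ≡ joinNew c' R' x y
    joinNew-cong c≗ R≗ fz     fz     = refl
    joinNew-cong c≗ R≗ fz     (fs j) = cong (λ x → does (x ≟ NEW)) (c≗ j)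
    joinNew-cong c≗ R≗ (fs i) fz     = cong (λ x → does (x ≟ NEW) ∧ true) (c≗ i)
    joinNew-cong c≗ R≗ (fs i) (fs j) = cong₂ _∨_ (R≗ i j) (cong₂ (λ x y → does (x ≟ NEW) ∧ does (y ≟ NEW)) (c≗ i) (c≗ j))

  count-eq : UFirst s n r τ (suc k) fz ≡ U s n (suc r) τ⁺ k
  count-eq = count-correspondence (λ o → labelledPartition? s τ (suc k) (fz ◂ proj₁ o) (proj₂ o))
    (λ o → labelledPartition? s τ⁺ k (proj₁ o) (proj₂ o)) (objects n (suc n) r) (objects n n (suc r)) correspondence

UFirst-no-blocks : (s n r : ℕ) (τ : Thresholds r) → UFirst s n r τ 0 fz ≡ 0
UFirst-no-blocks s n r τ = count-none (list (objects n (suc n) r)) _ (λ (c , R) → dec-false (labelledPartition? s τ 0 (fz ◂ c) R)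
  (λ p → contradiction (trans (sym (first-unlabelled-blocks c R)) (LabelledPartition.block-count p)) λ ()))

c₀ : {r : ℕ} → Labelling 0 r
c₀ ()

R₀ : Rel 0
R₀ ()

positive-threshold : (s r : ℕ) (τ : Thresholds r) (k : ℕ) → 1 ≤ s → ¬ LabelledPartition s τ k c₀ R₀ →
  Σ (Fin (k + r)) (λ b → withBlocks s k τ b ≢ 0)
positive-threshold s r τ (suc k) s≥1 ¬p = fz , λ s≡0 → contradiction (subst (1 ≤_) s≡0 s≥1) λ ()
positive-threshold s r τ zero    s≥1 ¬p with all? (λ l → τ l ℕ.≟ 0)
... | yes τ≡0 = contradiction (record
      { only-unlabelled = λ () ; reflexive = λ () ; symmetric = λ () ; transitive = λ ()
      ; block-count = refl ; block-size = λ () ; label-size = λ l → ≤-reflexive (τ≡0 l) }) ¬p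
... | no τ≢0  = ¬∀⟶∃¬ r _ (λ l → τ l ℕ.≟ 0) τ≢0

U-empty : (s r : ℕ) (τ : Thresholds r) (k : ℕ) → 1 ≤ s → k ! * U s 0 r τ k ≡ P (k + r) (withBlocks s k τ) 0
U-empty s r τ k s≥1 = trans (cong (k ! *_) single) (decided (labelledPartition? s τ k c₀ R₀))
  where
  empty-agree : (c : Labelling 0 r) (R : Rel 0) → does (labelledPartition? s τ k c R) ≡ does (labelledPartition? s τ k c₀ R₀)
  empty-agree c R = does-⇔ (labelledPartition-resp (λ ()) (λ ())) (labelledPartition-resp (λ ()) (λ ()))
                           (labelledPartition? s τ k c R) (labelledPartition? s τ k c₀ R₀)
  single : U s 0 r τ k ≡ ind (does (labelledPartition? s τ k c₀ R₀))
  single = trans (count-cong (list (objects 0 0 r)) (λ o → empty-agree (proj₁ o) (proj₂ o)))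
                 (trans (count-sumL (λ _ → does (labelledPartition? s τ k c₀ R₀)) (list (objects 0 0 r))) (+-identityʳ _))
  decided : (d : Dec (LabelledPartition s τ k c₀ R₀)) → k ! * ind (does d) ≡ P (k + r) (withBlocks s k τ) 0
  decided (yes p) with refl ← LabelledPartition.block-count p =
    sym (ThresholdFamily.base-zero (P-family r) τ (λ l → n≤0⇒n≡0 (LabelledPartition.label-size p l)))
  decided (no ¬p) = trans (*-zeroʳ (k !)) (sym (ThresholdFamily.base-pos (P-family (k + r)) _ b tb≢0))
    where
    b = proj₁ (positive-threshold s r τ k s≥1 ¬p)
    tb≢0 = proj₂ (positive-threshold s r τ k s≥1 ¬p)

-- Ordering the k blocks of a labelled partition gives the coefficients of the product:
-- k! U = P (s, …, s, τ).
U-coefficient : (s : ℕ) → 1 ≤ s → (n r : ℕ) (τ : Thresholds r) (k : ℕ) →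
  k ! * U s n r τ k ≡ P (k + r) (withBlocks s k τ) n
U-coefficient s s≥1 zero    r τ k = U-empty s r τ k s≥1
U-coefficient s s≥1 (suc n) r τ k = begin
    k ! * U s (suc n) r τ k
  ≡⟨ cong (k ! *_) (U-by-first-label s n r τ k) ⟩
    k ! * (UFirst s n r τ k fz + ∑[ l < r ] UFirst s n r τ k (fs l))
  ≡⟨ *-distribˡ-+ (k !) _ _ ⟩
    k ! * UFirst s n r τ k fz + k ! * ∑[ l < r ] UFirst s n r τ k (fs l)
  ≡⟨ cong₂ _+_ (new-block k) (trans (*-distribˡ-sum (k !) (λ l → UFirst s n r τ k (fs l))) (sum-cong-≗ labelled)) ⟩
    ∑[ a < k ] P (k + r) (lowerAt t (a ↑ˡ r)) n + ∑[ l < r ] P (k + r) (lowerAt t (k ↑ʳ l)) n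
  ≡⟨ sym (sum-↑ k r (λ x → P (k + r) (lowerAt t x) n)) ⟩
    ∑[ x < k + r ] P (k + r) (lowerAt t x) n
  ≡⟨ sym (ThresholdFamily.step (P-family (k + r)) t n) ⟩
    P (k + r) t (suc n) ∎
  where
  open ≡-Reasoning
  t = withBlocks s k τ
  labelled : ∀ l → k ! * UFirst s n r τ k (fs l) ≡ P (k + r) (lowerAt t (k ↑ʳ l)) n
  labelled l = begin
      k ! * UFirst s n r τ k (fs l)
    ≡⟨ cong (k ! *_) (LabelledFirst.count-eq s n r τ k l) ⟩
      k ! * U s n r (lowerAt τ l) k
    ≡⟨ U-coefficient s s≥1 n r (lowerAt τ l) k ⟩
      P (k + r) (withBlocks s k (lowerAt τ l)) n
    ≡⟨ sym (P-cong (k + r) (withBlocks-lowerʳ s k τ l) n) ⟩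
      P (k + r) (lowerAt t (k ↑ʳ l)) n ∎
  new-block : ∀ k → k ! * UFirst s n r τ k fz ≡ ∑[ a < k ] P (k + r) (lowerAt (withBlocks s k τ) (a ↑ˡ r)) n
  new-block zero = cong (1 *_) (UFirst-no-blocks s n r τ)
  new-block (suc k) = begin
      suc k ! * UFirst s n r τ (suc k) fz
    ≡⟨ cong (suc k ! *_) (UnlabelledFirst.count-eq s n r τ k) ⟩
      suc k * k ! * U s n (suc r) ((s ∸ 1) ◂ τ) k
    ≡⟨ *-assoc (suc k) (k !) _ ⟩
      suc k * (k ! * U s n (suc r) ((s ∸ 1) ◂ τ) k)
    ≡⟨ cong (suc k *_) (U-coefficient s s≥1 n (suc r) ((s ∸ 1) ◂ τ) k) ⟩
      suc k * P (k + suc r) (withBlocks s k ((s ∸ 1) ◂ τ)) n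
    ≡⟨ sym (sum-const (suc k) _) ⟩
      ∑[ a < suc k ] P (k + suc r) (withBlocks s k ((s ∸ 1) ◂ τ)) n
    ≡⟨ sum-cong-≗ (λ a → sym (P-lower-block s k τ a n)) ⟩
      ∑[ a < suc k ] P (suc k + r) (lowerAt (withBlocks s (suc k) τ) (a ↑ˡ r)) n ∎

all-allFin : (m : ℕ) (p : Fin m → Bool) → all p (allFin m) ≡ allᶠ m p
all-allFin m p = go m id
  where
  go : (k : ℕ) (h : Fin k → Fin m) → all p (tabulate h) ≡ allᶠ k (p ∘ h)
  go zero    h = refl
  go (suc m) h = cong (p (h fz) ∧_) (go m (h ∘ fs))

srTest : (s r K : ℕ) {N : ℕ} → Rel N → Bool
srTest s r K R = isEquivᵇ R ∧ (numBlocks R ≤ᵇ K) ∧ (K ≤ᵇ numBlocks R) ∧ blocksAtLeast R s ∧ firstDistinct R r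

record SrPartition (s r n K : ℕ) (R : Rel (r + n)) : Set where
  field
    reflexive    : ∀ x → R x x ≡ true
    symmetric    : ∀ x y → R x y ≡ true → R y x ≡ true
    transitive   : ∀ x y z → R x y ≡ true → R y z ≡ true → R x z ≡ true
    block-count  : sum (λ x → ind (isLeast R x)) ≡ K
    block-size   : ∀ x → s ≤ blockSize R x
    labels-apart : ∀ a b → a ≢ b → R (a ↑ˡ n) (b ↑ˡ n) ≡ false

module _ {s r n K : ℕ} {R : Rel (r + n)} where
  private
    N = r + n
    all-elim : (p : Fin N → Bool) → all p (allFin N) ≡ true → ∀ x → p x ≡ true
    all-elim p h = allᶠ-elim N (trans (sym (all-allFin N p)) h)
    all-intro : {p : Fin N → Bool} → (∀ x → p x ≡ true) → all p (allFin N) ≡ true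
    all-intro h = trans (all-allFin N _) (allᶠ-intro N h)

  numBlocks-sum : numBlocks R ≡ sum (λ x → ind (isLeast R x))
  numBlocks-sum = trans (count-allFin (λ i → all (λ j → (toℕ j <ᵇ toℕ i) ⇒ᵇ not (R j i)) (allFin N)))
                        (sum-cong-≗ {N} (λ i → cong ind (all-allFin N (λ j → (toℕ j <ᵇ toℕ i) ⇒ᵇ not (R j i)))))

  blockSize-length : ∀ x → length (block R x) ≡ blockSize R x
  blockSize-length x = count-allFin (R x)

  first-r : (a : Fin r) → (toℕ (a ↑ˡ n) <ᵇ r) ≡ true
  first-r a = trans (cong (_<ᵇ r) (toℕ-↑ˡ a n)) (dec-true (toℕ a <? r) (toℕ<n a))

  not-first-r : (i : Fin n) → (toℕ (r ↑ʳ i) <ᵇ r) ≡ false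
  not-first-r i = trans (cong (_<ᵇ r) (toℕ-↑ʳ r i)) (dec-false (r + toℕ i <? r) (m+n≮m r (toℕ i)))

  srTest-sound : srTest s r K R ≡ true → SrPartition s r n K R
  srTest-sound h = record
    { reflexive = all-elim _ refl′
    ; symmetric = λ x y → ⇒-elim (all-elim (λ y → R x y ⇒ᵇ R y x) (all-elim (λ x → all (λ y → R x y ⇒ᵇ R y x) (allFin N)) sym′ x) y)
    ; transitive = λ x y z Rxy Ryz → ⇒-elim (all-elim _ (all-elim _ (all-elim _ trans′ x) y) z) (∧-intro Rxy Ryz)
    ; block-count = trans (sym numBlocks-sum) (≤-antisym (witness (_ ≤? K) (∧-elimˡ h₁)) (witness (K ≤? _) (∧-elimˡ h₂)))
    ; block-size = λ x → subst (s ≤_) (blockSize-length x) (witness (s ≤? _) (all-elim _ (∧-elimˡ h₃) x))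
    ; labels-apart = λ a b a≢b → not-true (⇒-elim (all-elim _ (all-elim _ (∧-elimʳ {blocksAtLeast R s} h₃) (a ↑ˡ n)) (b ↑ˡ n))
        (∧-intro (first-r a) (∧-intro (first-r b)
          (cong not (trans (isYes≗does ((a ↑ˡ n) ≟ (b ↑ˡ n))) (dec-false ((a ↑ˡ n) ≟ (b ↑ˡ n)) (a≢b ∘ ↑ˡ-injective n a b)))))))
    }
    where
    refl′ = ∧-elimˡ {all (λ x → R x x) (allFin N)} (∧-elimˡ {isEquivᵇ R} h)
    sym′ = ∧-elimˡ {all (λ x → all (λ y → R x y ⇒ᵇ R y x) (allFin N)) (allFin N)} (∧-elimʳ {all (λ x → R x x) (allFin N)} (∧-elimˡ {isEquivᵇ R} h))
    trans′ = ∧-elimʳ {all (λ x → all (λ y → R x y ⇒ᵇ R y x) (allFin N)) (allFin N)}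
                     (∧-elimʳ {all (λ x → R x x) (allFin N)} (∧-elimˡ {isEquivᵇ R} h))
    h₁ = ∧-elimʳ {isEquivᵇ R} h
    h₂ = ∧-elimʳ {numBlocks R ≤ᵇ K} h₁
    h₃ = ∧-elimʳ {K ≤ᵇ numBlocks R} h₂

  srTest-complete : SrPartition s r n K R → srTest s r K R ≡ true
  srTest-complete p = ∧-intro
    (∧-intro (all-intro reflexive)
      (∧-intro (all-intro (λ x → all-intro (λ y → ⇒-intro (symmetric x y))))
               (all-intro (λ x → all-intro (λ y → all-intro (λ z → ⇒-intro (λ h → transitive x y z (∧-elimˡ h) (∧-elimʳ {R x y} h))))))))
    (∧-intro (dec-true (numBlocks R ≤? K) (≤-reflexive blocks))
    (∧-intro (dec-true (K ≤? numBlocks R) (≤-reflexive (sym blocks)))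
    (∧-intro (all-intro (λ x → dec-true (s ≤? _) (subst (s ≤_) (sym (blockSize-length x)) (block-size x))))
             (all-intro (λ x → all-intro (λ y → apart (side r n x) (side r n y)))))))
    where
    open SrPartition p
    blocks : numBlocks R ≡ K
    blocks = trans numBlocks-sum block-count
    apart : ∀ {x y} → Side r n x → Side r n y →
      (((toℕ x <ᵇ r) ∧ (toℕ y <ᵇ r) ∧ not (⌊ x ≟ y ⌋)) ⇒ᵇ not (R x y)) ≡ true
    apart {x} {y} (left a) (left b) rewrite first-r a | first-r b | isYes≗does (x ≟ y) with x ≟ y
    ... | yes _   = refl
    ... | no x≢y  = cong not (labels-apart a b (λ a≡b → x≢y (cong (_↑ˡ n) a≡b)))
    apart (left a)  (right j) rewrite first-r a | not-first-r j = refl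
    apart (right i) _         rewrite not-first-r i = refl

-- find m p is fs a for the first a with p a, and fz if there is none.
find : (m : ℕ) → (Fin m → Bool) → Fin (suc m)
find zero    p = fz
find (suc m) p = if p fz then fs fz else liftLabel (find m (p ∘ fs))

find-cong : (m : ℕ) {p q : Fin m → Bool} → (∀ b → p b ≡ q b) → find m p ≡ find m q
find-cong zero    p≗q = refl
find-cong (suc m) p≗q rewrite p≗q fz | find-cong m (p≗q ∘ fs) = refl

find-none : (m : ℕ) (p : Fin m → Bool) → (∀ b → p b ≡ false) → find m p ≡ fz
find-none zero    p none = refl
find-none (suc m) p none rewrite none fz | find-none m (p ∘ fs) (none ∘ fs) = refl

find-fz : (m : ℕ) (p : Fin m → Bool) → find m p ≡ fz → ∀ b → p b ≡ false
find-fz (suc m) p e b with p fz in p0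
find-fz (suc m) p () b      | true
find-fz (suc m) p e fz      | false = p0
find-fz (suc m) p e (fs b)  | false with find m (p ∘ fs) in e'
... | fz = find-fz m (p ∘ fs) e' b

find-fs : (m : ℕ) (p : Fin m → Bool) (a : Fin m) → find m p ≡ fs a → p a ≡ true
find-fs (suc m) p a e with p fz in p0
find-fs (suc m) p fz refl | true = p0
find-fs (suc m) p a e     | false with find m (p ∘ fs) in e'
find-fs (suc m) p (fs a) refl | false | fs .a = find-fs m (p ∘ fs) a e'

find-unique : (m : ℕ) (p : Fin m → Bool) (a : Fin m) → p a ≡ true → (∀ b → p b ≡ true → b ≡ a) → find m p ≡ fs a
find-unique m p a pa unique with find m p in e
... | fz   = contradiction (trans (sym pa) (find-fz m p e a)) λ ()
... | fs b = cong fs (unique b (find-fs m p b e))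

-- Fin (r + n) consists of r labelled elements followed by the n further ones; quantifiers,
-- the order, labels and relations are computed on the two parts.
module _ {r n : ℕ} where

  allᶠ-↑ : (p : Fin (r + n) → Bool) → allᶠ (r + n) p ≡ (allᶠ r (p ∘ (_↑ˡ n)) ∧ allᶠ n (p ∘ (r ↑ʳ_)))
  allᶠ-↑ p = go r p
    where
    go : (r : ℕ) (p : Fin (r + n) → Bool) → allᶠ (r + n) p ≡ (allᶠ r (p ∘ (_↑ˡ n)) ∧ allᶠ n (p ∘ (r ↑ʳ_)))
    go zero    p = refl
    go (suc r) p = trans (cong (p fz ∧_) (go r (p ∘ fs))) (sym (Bool.∧-assoc (p fz) _ _))

  <-↑ˡ↑ˡ : (a b : Fin r) → (toℕ (a ↑ˡ n) <ᵇ toℕ (b ↑ˡ n)) ≡ (toℕ a <ᵇ toℕ b)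
  <-↑ˡ↑ˡ a b rewrite toℕ-↑ˡ a n | toℕ-↑ˡ b n = refl

  <-↑ʳ↑ʳ : (i j : Fin n) → (toℕ (r ↑ʳ i) <ᵇ toℕ (r ↑ʳ j)) ≡ (toℕ i <ᵇ toℕ j)
  <-↑ʳ↑ʳ i j rewrite toℕ-↑ʳ r i | toℕ-↑ʳ r j = go r
    where
    go : ∀ r → (r + toℕ i <ᵇ r + toℕ j) ≡ (toℕ i <ᵇ toℕ j)
    go zero    = refl
    go (suc r) = go r

  <-↑ˡ↑ʳ : (a : Fin r) (i : Fin n) → (toℕ (a ↑ˡ n) <ᵇ toℕ (r ↑ʳ i)) ≡ true
  <-↑ˡ↑ʳ a i rewrite toℕ-↑ˡ a n | toℕ-↑ʳ r i = dec-true (toℕ a <? r + toℕ i) (≤-trans (toℕ<n a) (m≤m+n r (toℕ i)))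

  <-↑ʳ↑ˡ : (i : Fin n) (a : Fin r) → (toℕ (r ↑ʳ i) <ᵇ toℕ (a ↑ˡ n)) ≡ false
  <-↑ʳ↑ˡ i a rewrite toℕ-↑ˡ a n | toℕ-↑ʳ r i = dec-false (r + toℕ i <? toℕ a) (λ lt → <-asym lt (≤-trans (toℕ<n a) (m≤m+n r (toℕ i))) )

  labelOf : Labelling n r → Fin (r + n) → Fin (suc r)
  labelOf c x = [ fs , c ]′ (splitAt r x)

  labelOf-↑ˡ : (c : Labelling n r) (a : Fin r) → labelOf c (a ↑ˡ n) ≡ fs a
  labelOf-↑ˡ c a rewrite splitAt-↑ˡ r a n = refl

  labelOf-↑ʳ : (c : Labelling n r) (j : Fin n) → labelOf c (r ↑ʳ j) ≡ c j
  labelOf-↑ʳ c j rewrite splitAt-↑ʳ r n j = refl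

  onRight : Rel n → Rel (r + n)
  onRight R x y = [ (λ _ → false) , (λ i → [ (λ _ → false) , R i ]′ (splitAt r y)) ]′ (splitAt r x)

  onRight-↑ʳ : (R : Rel n) (i j : Fin n) → onRight R (r ↑ʳ i) (r ↑ʳ j) ≡ R i j
  onRight-↑ʳ R i j rewrite splitAt-↑ʳ r n i | splitAt-↑ʳ r n j = refl

  onRight-↑ˡ : (R : Rel n) (a : Fin r) (y : Fin (r + n)) → onRight R (a ↑ˡ n) y ≡ false
  onRight-↑ˡ R a y rewrite splitAt-↑ˡ r a n = refl

  onRight-↑ˡʳ : (R : Rel n) (i : Fin n) (b : Fin r) → onRight R (r ↑ʳ i) (b ↑ˡ n) ≡ false
  onRight-↑ˡʳ R i b rewrite splitAt-↑ʳ r n i | splitAt-↑ˡ r b n = refl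

  isLeast-↑ˡ : (Q : Rel (r + n)) (a : Fin r) → (∀ b → Q (b ↑ˡ n) (a ↑ˡ n) ≡ true → b ≡ a) → isLeast Q (a ↑ˡ n) ≡ true
  isLeast-↑ˡ Q a labelled-least = trans (allᶠ-↑ _) (∧-intro (allᶠ-intro r labelled) (allᶠ-intro n (λ j → cong (_⇒ᵇ not (Q (r ↑ʳ j) (a ↑ˡ n))) (<-↑ʳ↑ˡ j a))))
    where
    labelled : ∀ b → ((toℕ (b ↑ˡ n) <ᵇ toℕ (a ↑ˡ n)) ⇒ᵇ not (Q (b ↑ˡ n) (a ↑ˡ n))) ≡ true
    labelled b with Q (b ↑ˡ n) (a ↑ˡ n) in Qba
    ... | false = Bool.∨-zeroʳ _
    ... | true rewrite labelled-least b Qba | <-↑ˡ↑ˡ a a | dec-false (toℕ a <? toℕ a) (n≮n (toℕ a)) = refl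

  isLeast-↑ʳ : (Q : Rel (r + n)) (i : Fin n) →
    isLeast Q (r ↑ʳ i) ≡ (allᶠ r (λ b → not (Q (b ↑ˡ n) (r ↑ʳ i))) ∧ allᶠ n (λ j → (toℕ j <ᵇ toℕ i) ⇒ᵇ not (Q (r ↑ʳ j) (r ↑ʳ i))))
  isLeast-↑ʳ Q i = trans (allᶠ-↑ _) (cong₂ _∧_ (allᶠ-cong r (λ b → cong (_⇒ᵇ not (Q (b ↑ˡ n) (r ↑ʳ i))) (<-↑ˡ↑ʳ b i)))
                                                (allᶠ-cong n (λ j → cong (_⇒ᵇ not (Q (r ↑ʳ j) (r ↑ʳ i))) (<-↑ʳ↑ʳ j i))))

  blockSize-↑ : (Q : Rel (r + n)) (x : Fin (r + n)) →
    blockSize Q x ≡ sum (λ b → ind (Q x (b ↑ˡ n))) + sum (λ j → ind (Q x (r ↑ʳ j)))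
  blockSize-↑ Q x = sum-↑ r n (λ y → ind (Q x y))

sameLabel : {A : Set} {r : ℕ} → (A → Fin (suc r)) → A → A → Bool
sameLabel f x y = not (unlabelled (f x)) ∧ does (f x ≟ f y)

sameLabel-PER : {A : Set} {r : ℕ} (f : A → Fin (suc r)) → IsPER (sameLabel f)
sameLabel-PER f = record
  { sym′ = λ x y h → let fx≡fy = witness (f x ≟ f y) (∧-elimʳ {not (unlabelled (f x))} h) in
                     ∧-intro (trans (cong (not ∘ unlabelled) (sym fx≡fy)) (∧-elimˡ h)) (dec-true (f y ≟ f x) (sym fx≡fy))
  ; trans′ = λ x y z h h' → ∧-intro (∧-elimˡ h)
      (dec-true (f x ≟ f z) (trans (witness (f x ≟ f y) (∧-elimʳ {not (unlabelled (f x))} h))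
                                   (witness (f y ≟ f z) (∧-elimʳ {not (unlabelled (f y))} h'))))
  }

-- The partition of Fin (r + n) described by a labelled partition (c, R) of Fin n:
-- each label class joins its labelled element, and R relates the remaining elements.
joinLabels : {n r : ℕ} → Labelling n r → Rel n → Rel (r + n)
joinLabels c R x y = sameLabel (labelOf c) x y ∨ onRight R x y

module _ {n r : ℕ} (c : Labelling n r) (R : Rel n) where

  join-↑ˡ↑ˡ : ∀ a b → joinLabels c R (a ↑ˡ n) (b ↑ˡ n) ≡ does (a ≟ b)
  join-↑ˡ↑ˡ a b rewrite labelOf-↑ˡ c a | labelOf-↑ˡ c b | onRight-↑ˡ R a (b ↑ˡ n) = Bool.∨-identityʳ _

  join-↑ˡ↑ʳ : ∀ a j → joinLabels c R (a ↑ˡ n) (r ↑ʳ j) ≡ does (fs a ≟ c j)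
  join-↑ˡ↑ʳ a j rewrite labelOf-↑ˡ c a | labelOf-↑ʳ c j | onRight-↑ˡ R a (r ↑ʳ j) = Bool.∨-identityʳ _

  join-↑ʳ↑ˡ : ∀ i b → joinLabels c R (r ↑ʳ i) (b ↑ˡ n) ≡ (not (unlabelled (c i)) ∧ does (c i ≟ fs b))
  join-↑ʳ↑ˡ i b rewrite labelOf-↑ʳ c i | labelOf-↑ˡ c b | onRight-↑ˡʳ R i b = Bool.∨-identityʳ _

  join-↑ʳ↑ʳ : ∀ i j → joinLabels c R (r ↑ʳ i) (r ↑ʳ j) ≡ ((not (unlabelled (c i)) ∧ does (c i ≟ c j)) ∨ R i j)
  join-↑ʳ↑ʳ i j rewrite labelOf-↑ʳ c i | labelOf-↑ʳ c j = cong ((not (unlabelled (c i)) ∧ does (c i ≟ c j)) ∨_) (onRight-↑ʳ {r} R i j)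

  onRight-PER : IsPER R → IsPER (onRight {r} R)
  onRight-PER per = record
    { sym′ = λ x y → go (side r n x) (side r n y)
    ; trans′ = λ x y z → go₃ (side r n x) (side r n y) (side r n z) }
    where
    open IsPER per
    go : ∀ {x y} → Side r n x → Side r n y → onRight R x y ≡ true → onRight R y x ≡ true
    go (left a)  y         h = contradiction (trans (sym h) (onRight-↑ˡ R a _)) λ ()
    go (right i) (left b)  h = contradiction (trans (sym h) (onRight-↑ˡʳ R i b)) λ ()
    go (right i) (right j) h = trans (onRight-↑ʳ {r} R j i) (sym′ i j (trans (sym (onRight-↑ʳ {r} R i j)) h))
    go₃ : ∀ {x y z} → Side r n x → Side r n y → Side r n z → onRight R x y ≡ true → onRight R y z ≡ true → onRight R x z ≡ true
    go₃ (left a)  _         _         h h' = contradiction (trans (sym h) (onRight-↑ˡ R a _)) λ ()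
    go₃ (right i) (left b)  _         h h' = contradiction (trans (sym h) (onRight-↑ˡʳ R i b)) λ ()
    go₃ (right i) (right j) (left b)  h h' = contradiction (trans (sym h') (onRight-↑ˡʳ R j b)) λ ()
    go₃ (right i) (right j) (right m) h h' = trans (onRight-↑ʳ {r} R i m)
      (trans′ i j m (trans (sym (onRight-↑ʳ {r} R i j)) h) (trans (sym (onRight-↑ʳ {r} R j m)) h'))

no-label : {r : ℕ} (x : Fin (suc r)) → allᶠ r (λ b → not (does (fs b ≟ x))) ≡ unlabelled x
no-label {r} fz     = allᶠ-intro r (λ b → refl)
no-label {r} (fs a) = bool-ext (λ h → contradiction (trans (sym (allᶠ-elim r h a)) (cong not (dec-true (fs a ≟ fs a) refl))) λ ())
                               λ ()

module FromLabelled (s r n k : ℕ) {c : Labelling n r} {R : Rel n}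
  (q : LabelledPartition s (λ _ → s ∸ 1) k c R) where
  open LabelledPartition q

  private
    Q = joinLabels c R

  join-PER : IsPER Q
  join-PER = ∨-PER (sameLabel-PER (labelOf c)) (onRight-PER c R R-PER) disjoint
    where
    R-PER : IsPER R
    R-PER = record { sym′ = symmetric ; trans′ = transitive }
    disjoint : ∀ x y z → sameLabel (labelOf c) x y ≡ true → onRight R y z ≡ true → ⊥
    disjoint x y z h h' with side r n y | side r n z
    ... | left b  | _       = contradiction (trans (sym h') (onRight-↑ˡ R b z)) λ ()
    ... | right j | left b  = contradiction (trans (sym h') (onRight-↑ˡʳ R j b)) λ ()
    ... | right j | right m = contradiction (trans (sym (cong (not ∘ unlabelled) cj≡fz)) labelled-j) λ ()
      where
      cj≡fz : c j ≡ fz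
      cj≡fz = only-unlabelled j m (trans (sym (onRight-↑ʳ {r} R j m)) h')
      labelled-j : not (unlabelled (c j)) ≡ true
      labelled-j = trans (cong (not ∘ unlabelled) (sym (labelOf-↑ʳ c j)))
                         (subst (λ u → not (unlabelled u) ≡ true) (witness (labelOf c x ≟ labelOf c (r ↑ʳ j)) (∧-elimʳ {not (unlabelled (labelOf c x))} h)) (∧-elimˡ h))

  same-block : ∀ i a → c i ≡ fs a → ∀ y → Q (r ↑ʳ i) y ≡ Q (a ↑ˡ n) y
  same-block i a ci y with side r n y
  ... | left b  rewrite join-↑ʳ↑ˡ c R i b | join-↑ˡ↑ˡ c R a b | ci = refl
  ... | right j rewrite join-↑ʳ↑ʳ c R i j | join-↑ˡ↑ʳ c R a j | ci with R i j in Rij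
  ...   | true  = contradiction (trans (sym ci) (only-unlabelled i j Rij)) λ ()
  ...   | false = Bool.∨-identityʳ _

  labelled-block-size : ∀ a → blockSize Q (a ↑ˡ n) ≡ suc (labelSize c a)
  labelled-block-size a = trans (blockSize-↑ {r} {n} Q (a ↑ˡ n))
    (cong₂ _+_ (trans (sum-cong-≗ (λ b → cong ind (join-↑ˡ↑ˡ c R a b))) (∑-point′ a))
               (sum-cong-≗ (λ j → cong ind (trans (join-↑ˡ↑ʳ c R a j) (≟-sym (fs a) (c j))))))
    where
    ∑-point′ : ∀ {m} (a : Fin m) → sum (λ b → ind (does (a ≟ b))) ≡ 1
    ∑-point′ a = trans (sum-cong-≗ (λ b → cong ind (≟-sym a b))) (∑-point a)

  join-reflexive : ∀ {x} → Side r n x → Q x x ≡ true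
  join-reflexive (left a)  = trans (join-↑ˡ↑ˡ c R a a) (dec-true (a ≟ a) refl)
  join-reflexive (right i) with c i in ci
  ... | fz   = trans (join-↑ʳ↑ʳ c R i i) (trans (cong (λ u → (not (unlabelled u) ∧ does (u ≟ c i)) ∨ R i i) ci) (reflexive i ci))
  ... | fs a = trans (same-block i a ci (r ↑ʳ i)) (trans (join-↑ˡ↑ʳ c R a i) (dec-true (fs a ≟ c i) (sym ci)))
  labelled-least : ∀ a b → Q (b ↑ˡ n) (a ↑ˡ n) ≡ true → b ≡ a
  labelled-least a b h = witness (b ≟ a) (trans (sym (join-↑ˡ↑ˡ c R b a)) h)
  join-least : ∀ i → isLeast Q (r ↑ʳ i) ≡ (unlabelled (c i) ∧ isLeast R i)
  join-least i = trans (isLeast-↑ʳ {r} {n} Q i) (trans (cong (_∧ allᶠ n (λ j → (toℕ j <ᵇ toℕ i) ⇒ᵇ not (Q (r ↑ʳ j) (r ↑ʳ i)))) unlabelled-part) unlabelled-cond)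
    where
    unlabelled-part : allᶠ r (λ b → not (Q (b ↑ˡ n) (r ↑ʳ i))) ≡ unlabelled (c i)
    unlabelled-part = trans (allᶠ-cong r (λ b → cong not (join-↑ˡ↑ʳ c R b i))) (no-label (c i))
    never : ∀ u → (not (unlabelled u) ∧ does (u ≟ fz)) ≡ false
    never fz     = refl
    never (fs a) = refl
    unlabelled-cond : (unlabelled (c i) ∧ allᶠ n (λ j → (toℕ j <ᵇ toℕ i) ⇒ᵇ not (Q (r ↑ʳ j) (r ↑ʳ i))))
                    ≡ (unlabelled (c i) ∧ isLeast R i)
    unlabelled-cond with c i in ci
    ... | fs a = refl
    ... | fz   = allᶠ-cong n (λ j → cong (λ b → (toℕ j <ᵇ toℕ i) ⇒ᵇ not b)
                   (trans (join-↑ʳ↑ʳ c R j i) (trans (cong (λ u → (not (unlabelled (c j)) ∧ does (c j ≟ u)) ∨ R j i) ci)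
                                                     (cong (_∨ R j i) (never (c j))))))
  join-block-size : ∀ {x} → Side r n x → s ≤ blockSize Q x
  join-block-size (left a) = subst (s ≤_) (sym (labelled-block-size a)) (≤-trans (m≤n+m∸n s 1) (+-monoʳ-≤ 1 (label-size a)))
  join-block-size (right i) with c i in ci
  ... | fs a = subst (s ≤_) (sum-cong-≗ (λ y → cong ind (sym (same-block i a ci y)))) (join-block-size (left a))
  ... | fz   = subst (s ≤_) (sym size) (block-size i ci)
    where
    size : blockSize Q (r ↑ʳ i) ≡ blockSize R i
    size = trans (blockSize-↑ {r} {n} Q (r ↑ʳ i))
      (cong₂ _+_ (sum-zero _ (λ b → cong ind (trans (join-↑ʳ↑ˡ c R i b) (cong (λ u → not (unlabelled u) ∧ does (u ≟ fs b)) ci))))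
                 (sum-cong-≗ (λ j → cong ind (trans (join-↑ʳ↑ʳ c R i j) (cong (λ u → (not (unlabelled u) ∧ does (u ≟ c j)) ∨ R i j) ci)))))

  joined : SrPartition s r n (k + r) Q
  joined = record
    { reflexive = λ x → join-reflexive (side r n x)
    ; symmetric = IsPER.sym′ join-PER
    ; transitive = IsPER.trans′ join-PER
    ; block-count = trans (sum-↑ r n (λ x → ind (isLeast Q x)))
        (trans (cong₂ _+_ (trans (sum-cong-≗ (λ a → cong ind (isLeast-↑ˡ Q a (labelled-least a)))) (trans (sum-const r 1) (*-identityʳ r)))
                          (trans (sum-cong-≗ (λ i → cong ind (join-least i))) block-count))
               (+-comm r k))
    ; block-size = λ x → join-block-size (side r n x)
    ; labels-apart = λ a b a≢b → trans (join-↑ˡ↑ˡ c R a b) (dec-false (a ≟ b) a≢b)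
    }

-- From a partition of Fin (r + n): the label of an element is that of the labelled
-- element in its block, and the remaining elements keep their relations.
labelsOf : {r n : ℕ} → Rel (r + n) → Labelling n r
labelsOf {r} {n} R i = find r (λ a → R (a ↑ˡ n) (r ↑ʳ i))

restOf : {r n : ℕ} → Rel (r + n) → Rel n
restOf {r} {n} R i j = unlabelled (labelsOf {r} {n} R i) ∧ R (r ↑ʳ i) (r ↑ʳ j)

module ToLabelled (s r n k : ℕ) {R : Rel (r + n)} (p : SrPartition s r n (k + r) R) where
  open SrPartition p

  private
    c = labelsOf {r} {n} R
    rest = restOf {r} {n} R

  R-sym : ∀ x y → R x y ≡ R y x
  R-sym x y = bool-ext (symmetric x y) (symmetric y x)

  labelled-apart : ∀ a b → R (a ↑ˡ n) (b ↑ˡ n) ≡ does (a ≟ b)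
  labelled-apart a b with a ≟ b
  ... | yes refl = reflexive (a ↑ˡ n)
  ... | no a≢b   = labels-apart a b a≢b

  unique-label : ∀ i a b → R (a ↑ˡ n) (r ↑ʳ i) ≡ true → R (b ↑ˡ n) (r ↑ʳ i) ≡ true → b ≡ a
  unique-label i a b Rai Rbi = witness (b ≟ a) (trans (sym (labelled-apart b a))
    (transitive (b ↑ˡ n) (r ↑ʳ i) (a ↑ˡ n) Rbi (symmetric (a ↑ˡ n) (r ↑ʳ i) Rai)))

  labels-correct : ∀ i a → does (c i ≟ fs a) ≡ R (a ↑ˡ n) (r ↑ʳ i)
  labels-correct i a = bool-ext (λ h → find-fs r _ a (witness (c i ≟ fs a) h))
    (λ Rai → dec-true (c i ≟ fs a) (find-unique r _ a Rai (λ b Rbi → unique-label i a b Rai Rbi)))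

  unlabelled-apart : ∀ i → c i ≡ fz → ∀ a → R (a ↑ˡ n) (r ↑ʳ i) ≡ false
  unlabelled-apart i = find-fz r _

  unlabelled-closed : ∀ i j → c i ≡ fz → R (r ↑ʳ i) (r ↑ʳ j) ≡ true → c j ≡ fz
  unlabelled-closed i j ci Rij = find-none r _ apart
    where
    apart : ∀ a → R (a ↑ˡ n) (r ↑ʳ j) ≡ false
    apart a with R (a ↑ˡ n) (r ↑ʳ j) in Raj
    ... | true  = contradiction (trans (sym (transitive (a ↑ˡ n) (r ↑ʳ j) (r ↑ʳ i) Raj (symmetric (r ↑ʳ i) (r ↑ʳ j) Rij)))
                                       (unlabelled-apart i ci a)) λ ()
    ... | false = refl

  unlabelled-true : ∀ {x : Fin (suc r)} → unlabelled x ≡ true → x ≡ fz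
  unlabelled-true {fz} _ = refl

  least-↑ʳ : ∀ i → isLeast R (r ↑ʳ i) ≡ (unlabelled (c i) ∧ isLeast rest i)
  least-↑ʳ i = trans (isLeast-↑ʳ {r} {n} R i)
    (trans (cong (_∧ allᶠ n (λ j → (toℕ j <ᵇ toℕ i) ⇒ᵇ not (R (r ↑ʳ j) (r ↑ʳ i))))
                 (trans (allᶠ-cong r (λ b → cong not (sym (labels-correct i b)))) (unlabelled-via (c i))))
           unlabelled-cond)
    where
    unlabelled-via : ∀ x → allᶠ r (λ b → not (does (x ≟ fs b))) ≡ unlabelled x
    unlabelled-via x = trans (allᶠ-cong r (λ b → cong not (≟-sym x (fs b)))) (no-label x)
    unlabelled-cond : (unlabelled (c i) ∧ allᶠ n (λ j → (toℕ j <ᵇ toℕ i) ⇒ᵇ not (R (r ↑ʳ j) (r ↑ʳ i))))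
                    ≡ (unlabelled (c i) ∧ isLeast rest i)
    unlabelled-cond with c i in ci
    ... | fs a = refl
    ... | fz   = allᶠ-cong n (λ j → cong (λ b → (toℕ j <ᵇ toℕ i) ⇒ᵇ not b) (closed j))
      where
      closed : ∀ j → R (r ↑ʳ j) (r ↑ʳ i) ≡ rest j i
      closed j with R (r ↑ʳ j) (r ↑ʳ i) in Rji
      ... | true  = sym (cong (λ u → unlabelled u ∧ true) (unlabelled-closed i j ci (symmetric (r ↑ʳ j) (r ↑ʳ i) Rji)))
      ... | false = sym (Bool.∧-zeroʳ _)

  rest-blocks : r + unlabelledBlocks c rest ≡ k + r
  rest-blocks = trans (cong₂ _+_ (sym (trans (sum-cong-≗ (λ a → cong ind (isLeast-↑ˡ R a (λ b h → witness (b ≟ a) (trans (sym (labelled-apart b a)) h)))))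
                                       (trans (sum-const r 1) (*-identityʳ r))))
                           (sum-cong-≗ (λ i → cong ind (sym (least-↑ʳ i)))))
                (trans (sym (sum-↑ r n (λ x → ind (isLeast R x)))) block-count)
  rest-block-size : ∀ i → c i ≡ fz → blockSize R (r ↑ʳ i) ≡ blockSize rest i
  rest-block-size i ci = trans (blockSize-↑ {r} {n} R (r ↑ʳ i))
    (cong₂ _+_ (sum-zero _ (λ b → cong ind (trans (R-sym (r ↑ʳ i) (b ↑ˡ n)) (unlabelled-apart i ci b))))
               (sum-cong-≗ (λ j → cong (λ u → ind (unlabelled u ∧ R (r ↑ʳ i) (r ↑ʳ j))) (sym ci))))
  labelled-class-size : ∀ a → blockSize R (a ↑ˡ n) ≡ 1 + labelSize c a
  labelled-class-size a = trans (blockSize-↑ {r} {n} R (a ↑ˡ n))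
    (cong₂ _+_ (trans (sum-cong-≗ (λ b → cong ind (trans (labelled-apart a b) (≟-sym a b)))) (∑-point a))
               (sum-cong-≗ (λ j → cong ind (sym (labels-correct j a)))))

  removed : LabelledPartition s (λ _ → s ∸ 1) k c rest
  removed = record
    { only-unlabelled = λ i j h → unlabelled-true (∧-elimˡ h)
    ; reflexive = λ i ci → ∧-intro (cong unlabelled ci) (reflexive (r ↑ʳ i))
    ; symmetric = λ i j h → ∧-intro (cong unlabelled (unlabelled-closed i j (unlabelled-true (∧-elimˡ h)) (∧-elimʳ {unlabelled (c i)} h)))
                                    (symmetric (r ↑ʳ i) (r ↑ʳ j) (∧-elimʳ {unlabelled (c i)} h))
    ; transitive = λ i j m h h' → ∧-intro (∧-elimˡ h) (transitive (r ↑ʳ i) (r ↑ʳ j) (r ↑ʳ m) (∧-elimʳ {unlabelled (c i)} h) (∧-elimʳ {unlabelled (c j)} h'))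
    ; block-count = +-cancelˡ-≡ r _ _ (trans rest-blocks (+-comm k r))
    ; block-size = λ i ci → subst (s ≤_) (rest-block-size i ci) (block-size (r ↑ʳ i))
    ; label-size = λ a → m≤n+o⇒m∸n≤o s 1 (subst (s ≤_) (labelled-class-size a) (block-size (a ↑ˡ n)))
    }

  restored : ∀ x y → joinLabels c rest x y ≡ R x y
  restored x y = go (side r n x) (side r n y)
    where
    go : ∀ {x y} → Side r n x → Side r n y → joinLabels c rest x y ≡ R x y
    go (left a)  (left b)  = trans (join-↑ˡ↑ˡ c rest a b) (sym (labelled-apart a b))
    go (left a)  (right j) = trans (join-↑ˡ↑ʳ c rest a j) (trans (≟-sym (fs a) (c j)) (labels-correct j a))
    go (right i) (left b)  = trans (join-↑ʳ↑ˡ c rest i b) (trans (labelled-part (c i) refl) (R-sym (b ↑ˡ n) (r ↑ʳ i)))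
      where
      labelled-part : ∀ u → c i ≡ u → (not (unlabelled u) ∧ does (u ≟ fs b)) ≡ R (b ↑ˡ n) (r ↑ʳ i)
      labelled-part fz     ci = sym (unlabelled-apart i ci b)
      labelled-part (fs a) ci = trans (cong (λ u → does (u ≟ fs b)) (sym ci)) (labels-correct i b)
    go (right i) (right j) = trans (join-↑ʳ↑ʳ c rest i j) (by-label (c i) refl)
      where
      by-label : ∀ u → c i ≡ u → ((not (unlabelled u) ∧ does (u ≟ c j)) ∨ (unlabelled (c i) ∧ R (r ↑ʳ i) (r ↑ʳ j))) ≡ R (r ↑ʳ i) (r ↑ʳ j)
      by-label fz ci rewrite ci = refl
      by-label (fs a) ci rewrite ci = trans (Bool.∨-identityʳ _) (trans (≟-sym (fs a) (c j)) (trans (labels-correct j a)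
        (bool-ext (λ Raj → transitive (r ↑ʳ i) (a ↑ˡ n) (r ↑ʳ j) (symmetric (a ↑ˡ n) (r ↑ʳ i) Rai) Raj)
                  (λ Rij → transitive (a ↑ˡ n) (r ↑ʳ i) (r ↑ʳ j) Rai Rij))))
        where
        Rai : R (a ↑ˡ n) (r ↑ʳ i) ≡ true
        Rai = trans (sym (labels-correct i a)) (dec-true (c i ≟ fs a) ci)

find-label : {r : ℕ} (x : Fin (suc r)) → find r (λ a → does (fs a ≟ x)) ≡ x
find-label {r} fz     = find-none r _ (λ b → refl)
find-label {r} (fs a) = find-unique r _ a (dec-true (fs a ≟ fs a) refl) (λ b h → fs-injective (witness (fs b ≟ fs a) h))

module _ (s r n k : ℕ) {c : Labelling n r} {R : Rel n} (q : LabelledPartition s (λ _ → s ∸ 1) k c R) where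
  open LabelledPartition q

  labels-back : ∀ i → labelsOf {r} {n} (joinLabels c R) i ≡ c i
  labels-back i = trans (find-cong r (λ a → join-↑ˡ↑ʳ c R a i)) (find-label (c i))

  rest-back : ∀ i j → restOf {r} {n} (joinLabels c R) i j ≡ R i j
  rest-back i j rewrite labels-back i | join-↑ʳ↑ʳ c R i j with c i in ci
  ... | fz   = refl
  ... | fs a with R i j in Rij
  ...   | true  = contradiction (trans (sym ci) (only-unlabelled i j Rij)) λ ()
  ...   | false = refl

module _ {r n : ℕ} where

  labelOf-cong : {c c' : Labelling n r} → (∀ i → c i ≡ c' i) → ∀ x → labelOf c x ≡ labelOf c' x
  labelOf-cong c≗c' x with splitAt r x
  ... | inj₁ a = refl
  ... | inj₂ j = c≗c' j

  onRight-cong : {R R' : Rel n} → (∀ i j → R i j ≡ R' i j) → ∀ x y → onRight {r} R x y ≡ onRight R' x y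
  onRight-cong R≗R' x y with splitAt r x | splitAt r y
  ... | inj₁ a | _      = refl
  ... | inj₂ i | inj₁ b = refl
  ... | inj₂ i | inj₂ j = R≗R' i j

  joinLabels-cong : {c c' : Labelling n r} {R R' : Rel n} → (∀ i → c i ≡ c' i) → (∀ i j → R i j ≡ R' i j) →
    ∀ x y → joinLabels c R x y ≡ joinLabels c' R' x y
  joinLabels-cong c≗c' R≗R' x y = cong₂ _∨_
    (cong₂ (λ u v → not (unlabelled u) ∧ does (u ≟ v)) (labelOf-cong c≗c' x) (labelOf-cong c≗c' y))
    (onRight-cong R≗R' x y)

  SrPartition-resp : {s K : ℕ} {R R' : Rel (r + n)} → (∀ x y → R x y ≡ R' x y) → SrPartition s r n K R → SrPartition s r n K R'
  SrPartition-resp R≗R' p = record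
    { reflexive = λ x → trans (sym (R≗R' x x)) (reflexive x)
    ; symmetric = λ x y h → trans (sym (R≗R' y x)) (symmetric x y (trans (R≗R' x y) h))
    ; transitive = λ x y z h h' → trans (sym (R≗R' x z)) (transitive x y z (trans (R≗R' x y) h) (trans (R≗R' y z) h'))
    ; block-count = trans (sum-cong-≗ (λ x → cong ind (sym (isLeast-cong R≗R' x)))) block-count
    ; block-size = λ x → subst (_ ≤_) (blockSize-cong R≗R' x) (block-size x)
    ; labels-apart = λ a b a≢b → trans (sym (R≗R' (a ↑ˡ n) (b ↑ˡ n))) (labels-apart a b a≢b)
    }
    where open SrPartition p

srPartition? : (s r n K : ℕ) (R : Rel (r + n)) → Dec (SrPartition s r n K R)
srPartition? s r n K R = map′ srTest-sound srTest-complete (srTest s r K R Bool.≟ true)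

Sr-as-U : (s r n k : ℕ) → Sr s r (r + n) (k + r) ≡ U s n r (λ _ → s ∸ 1) k
Sr-as-U s r n k = begin
    Sr s r (r + n) (k + r)
  ≡⟨⟩
    count (srTest s r (k + r)) (allRels (r + n))
  ≡⟨ count-cong (allRels (r + n)) (λ R → sym (does-≟-true (srTest s r (k + r) R))) ⟩
    count (does ∘ srPartition? s r n (k + r)) (list (relations (r + n)))
  ≡⟨ count-correspondence (srPartition? s r n (k + r)) (λ o → labelledPartition? s (λ _ → s ∸ 1) k (proj₁ o) (proj₂ o))
                          (relations (r + n)) (objects n n r) correspondence ⟩
    U s n r (λ _ → s ∸ 1) k ∎
  where
  open ≡-Reasoning
  does-≟-true : ∀ b → does (b Bool.≟ true) ≡ b
  does-≟-true true  = refl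
  does-≟-true false = refl
  correspondence : Correspondence (RelS (r + n)) (ObjS n n r)
    (SrPartition s r n (k + r)) (λ o → LabelledPartition s (λ _ → s ∸ 1) k (proj₁ o) (proj₂ o))
  correspondence = record
    { to = λ R → labelsOf {r} {n} R , restOf {r} {n} R
    ; from = λ (c , R) → joinLabels c R
    ; to-cong = λ R≗R' → (λ i → find-cong r (λ a → R≗R' (a ↑ˡ n) (r ↑ʳ i)))
                       , (λ i j → cong₂ (λ u b → unlabelled u ∧ b) (find-cong r (λ a → R≗R' (a ↑ˡ n) (r ↑ʳ i))) (R≗R' (r ↑ʳ i) (r ↑ʳ j)))
    ; from-cong = λ (c≗c' , R≗R') → joinLabels-cong c≗c' R≗R'
    ; P-resp = SrPartition-resp
    ; Q-resp = λ (c≗c' , R≗R') → labelledPartition-resp c≗c' R≗R'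
    ; to-ok = ToLabelled.removed s r n k
    ; from-ok = FromLabelled.joined s r n k
    ; from-to = ToLabelled.restored s r n k
    ; to-from = λ q → labels-back s r n k q , rest-back s r n k q
    }

k!Sr≡coefficient : (s : ℕ) → 1 ≤ s → (r k n : ℕ) →
  k ! * Sr s r (n + r) (k + r) ≡ conv (P k (λ _ → s)) (P r (λ _ → s ∸ 1)) n
k!Sr≡coefficient s s≥1 r k n = begin
    k ! * Sr s r (n + r) (k + r)
  ≡⟨ cong (λ N → k ! * Sr s r N (k + r)) (+-comm n r) ⟩
    k ! * Sr s r (r + n) (k + r)
  ≡⟨ cong (k ! *_) (Sr-as-U s r n k) ⟩
    k ! * U s n r (λ _ → s ∸ 1) k
  ≡⟨ U-coefficient s s≥1 n r (λ _ → s ∸ 1) k ⟩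
    P (k + r) (withBlocks s k (λ _ → s ∸ 1)) n
  ≡⟨ P-split k r _ n ⟩
    conv (P k (withBlocks s k (λ _ → s ∸ 1) ∘ (_↑ˡ r))) (P r (withBlocks s k (λ _ → s ∸ 1) ∘ (k ↑ʳ_))) n
  ≡⟨ conv-cong (P-cong k (withBlocks-↑ˡ s k _)) (P-cong r (withBlocks-↑ʳ s k _)) n ⟩
    conv (P k (λ _ → s)) (P r (λ _ → s ∸ 1)) n ∎
  where
  open ≡-Reasoning

coefficient-vanish : (s r k n : ℕ) → n < s * k + (s ∸ 1) * r → conv (P k (λ _ → s)) (P r (λ _ → s ∸ 1)) n ≡ 0
coefficient-vanish s r k n n<order = conv-vanish _ _ (k * s) (r * (s ∸ 1)) n
  (λ i i<ks → P-vanish k (λ _ → s) i (subst (i <_) (sym (sum-const k s)) i<ks))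
  (λ j j<rs → P-vanish r (λ _ → s ∸ 1) j (subst (j <_) (sym (sum-const r (s ∸ 1))) j<rs))
  (subst (n <_) (cong₂ _+_ (*-comm s k) (*-comm (s ∸ 1) r)) n<order)

/!-cancel : (S k n : ℕ) → S /! n ≡ invFact k *ℚ (k ! * S) /! n
/!-cancel S k n = sym (trans (/-* 1 (k !) (k ! * S) (n !) {{k !≢0}} {{n !≢0}})
  (/-cross (1 * (k ! * S)) (k ! * n !) S (n !) {{m*n≢0 (k !) (n !) {{k !≢0}} {{n !≢0}}}} {{n !≢0}}
           (trans (cong (_* n !) (+-identityʳ (k ! * S))) (trans (cong (_* n !) (*-comm (k !) S)) (*-assoc S (k !) (n !))))))

lhs-coeff : (s r k n : ℕ) (b : Bool) → ((s * k + (s ∸ 1) * r) ≤ᵇ n) ≡ b →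
  lhsS s r k n ≡ (if b then Sr s r (n + r) (k + r) /! n else 0ℚ)
lhs-coeff s r k n b e = cong (λ b → if b then Sr s r (n + r) (k + r) /! n else 0ℚ) e

coefficients-from-order : (s : ℕ) → 1 ≤ s → (r k n : ℕ) → s * k + (s ∸ 1) * r ≤ n → lhsS s r k n ≡ rhsS s r k n
coefficients-from-order s s≥1 r k n order≤n = begin
    lhsS s r k n
  ≡⟨ lhs-coeff s r k n true (dec-true ((s * k + (s ∸ 1) * r) ≤? n) order≤n) ⟩
    Sr s r (n + r) (k + r) /! n
  ≡⟨ /!-cancel _ k n ⟩
    invFact k *ℚ (k ! * Sr s r (n + r) (k + r)) /! n
  ≡⟨ cong (λ a → invFact k *ℚ a /! n) (k!Sr≡coefficient s s≥1 r k n) ⟩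
    invFact k *ℚ conv (P k (λ _ → s)) (P r (λ _ → s ∸ 1)) n /! n
  ≡⟨ sym (rhs-coeff s r k n) ⟩
    rhsS s r k n ∎
  where open ≡-Reasoning

coefficients-below-order : (s r k n : ℕ) → ¬ (s * k + (s ∸ 1) * r ≤ n) → lhsS s r k n ≡ rhsS s r k n
coefficients-below-order s r k n order≰n = begin
    lhsS s r k n
  ≡⟨ lhs-coeff s r k n false (dec-false ((s * k + (s ∸ 1) * r) ≤? n) order≰n) ⟩
    0ℚ
  ≡⟨ sym (ℚ.*-zeroʳ (invFact k)) ⟩
    invFact k *ℚ 0ℚ
  ≡⟨ cong (invFact k *ℚ_) (sym (/!-zero n)) ⟩
    invFact k *ℚ 0 /! n
  ≡⟨ cong (λ a → invFact k *ℚ a /! n) (sym (coefficient-vanish s r k n (≰⇒> order≰n))) ⟩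
    invFact k *ℚ conv (P k (λ _ → s)) (P r (λ _ → s ∸ 1)) n /! n
  ≡⟨ sym (rhs-coeff s r k n) ⟩
    rhsS s r k n ∎
  where open ≡-Reasoning

mainTheorem19 : (s : ℕ) → 1 ≤ s → (r k : ℕ) → (n : ℕ) → lhsS s r k n ≡ rhsS s r k n
mainTheorem19 s s≥1 r k n =
  [ coefficients-from-order s s≥1 r k n , coefficients-below-order s r k n ]′ (toSum ((s * k + (s ∸ 1) * r) ≤? n))
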